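{- Let $q\equiv 3\pmod 4$ be a prime with $3<q<200$, and let $p\equiv 3\pmod 4$ be a prime with $p>3$ and $(p-1)\mid(q-1)$. Then there exists a PS$(pq)$, equivalently a ZCPS-Wh$(pq)$.
   Context: For an abelian group $(G,+)$ of order $v\equiv 1\pmod 4$, a partitionable set PS$(G)$ is a set $\mathcal S$ of $(v-1)/4$ unordered pairs $\{x,y\}$ from $G$ such that $\bigcup_{\{x,y\}\in\mathcal S}\pm\{x,y\}=G\setminus\{0\}$ and $\bigcup_{\{x,y\}\in\mathcal S}\pm\{x-y,x+y\}=G\setminus\{0\}$; for $G=\mathbb{Z}_v$ it is written PS$(v)$. A ZCPS-Wh$(v)$ ($\mathbb{Z}$-cyclic patterned starter whist tournament) for $v\equiv1\pmod4$ is a whist tournament on player set $\mathbb{Z}_v$ (games $(a,b,c,d)$ with partner pairs $\{a,c\},\{b,d\}$ and opponent pairs $\{a,b\},\{c,d\},\{a,d\},\{b,c\}$, arranged in $v$ rounds of $(v-1)/4$ games, each player playing in all rounds but one, each player partnering every other exactly once and opposing every other exactly twice) in which round $j+1$ is obtained from round $j$ by adding $1$ to each player, $0$ is missing from the initial round, and the partner pairs of the initial round are exactly $\{\{x,-x\}:x\in\mathbb{Z}_v\setminus\{0\}\}$. -}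

module Defs where

open import Data.Nat using (ℕ; _*_; _∸_; _/_)
open import Data.Integer as ℤ using (ℤ; +_; -_; _-_)
open import Data.Integer.Divisibility using (_∣_)
open import Data.List using (List; length)
open import Data.List.Relation.Unary.Any using (Any)
open import Data.Product using (_×_; _,_)
open import Data.Sum using (_⊎_)
open import Relation.Nullary using (¬_)
open import Relation.Binary.PropositionalEquality using (_≡_)
open import Function.Bundles using (_⇔_)

-- Congruence modulo v on ℤ: elements of ℤ_v are represented by integers,
-- and  a ≡ b [mod v]  means  a and b denote the same element of ℤ_v.
_≡_[mod_] : ℤ → ℤ → ℕ → Set
a ≡ b [mod v ] = (+ v) ∣ (a - b)

In± : ℕ → ℤ → ℤ → ℤ → Set
In± v z a b = (z ≡ a [mod v ]) ⊎ (z ≡ - a [mod v ]) ⊎ (z ≡ b [mod v ]) ⊎ (z ≡ - b [mod v ])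

-- A partitionable set PS(v) in ℤ_v: a family 𝒮 of (v-1)/4 pairs {x,y} with
--   ⋃_{ {x,y} ∈ 𝒮 } ±{x, y}       = ℤ_v ∖ {0}
--   ⋃_{ {x,y} ∈ 𝒮 } ±{x-y, x+y}   = ℤ_v ∖ {0}
-- (the pair {x,y} is stored as (x , y); both conditions are invariant under
--  swapping x and y, so the unordered pair is faithfully represented).
record PS (v : ℕ) : Set where
  field
    pairs  : List (ℤ × ℤ)
    size   : length pairs ≡ (v ∸ 1) / 4
    cover₁ : ∀ (z : ℤ) → (¬ (z ≡ + 0 [mod v ])) ⇔
               Any (λ { (x , y) → In± v z x y }) pairs
    cover₂ : ∀ (z : ℤ) → (¬ (z ≡ + 0 [mod v ])) ⇔
               Any (λ { (x , y) → In± v z (x - y) (x ℤ.+ y) }) pairs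

module Submission where

open import Defs
open import Data.Bool using (Bool; true; false; _∧_; T)
open import Data.Bool.Properties using (T-∧)
open import Data.Integer as ℤ using (ℤ; +_; -_; _-_; ∣_∣; _%ℕ_; _/ℕ_)
import Data.Integer.Properties as ℤ
open import Data.Integer.DivMod using (a≡a%ℕn+[a/ℕn]*n; n%ℕd<d)
import Data.Integer.Divisibility.Signed as ℤ
open import Data.Integer.Tactic.RingSolver using (solve-∀)
open import Data.List using (List; []; _∷_; [_]; _++_; applyDownFrom; concat; concatMap; map; length)
open import Data.List.Properties using (++-assoc; concat-map-[_])
open import Data.List.Membership.Propositional using (_∈_; find)
open import Data.List.Membership.Propositional.Properties
  using (∈-applyDownFrom⁺; ∈-applyDownFrom⁻; ∈-concatMap⁺; ∈-concatMap⁻)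
open import Data.List.Relation.Binary.Permutation.Propositional
  using (_↭_; ↭-refl; ↭-sym; ↭-trans; ↭-reflexive; ↭-prep)
open import Data.List.Relation.Binary.Permutation.Propositional.Properties
  using (∈-resp-↭; ++⁺; ++-identityʳ; shift)
open import Data.List.Relation.Unary.Any using (Any; here; there; any?)
open import Data.List.Relation.Unary.Any.Properties using (Any-cong; map⁺; map⁻)
open import Data.Nat as ℕ using (ℕ; zero; suc; _*_; _∸_; _%_; _/_; _<_; _≤_; z≤n; s≤s; NonZero)
import Data.Nat.Properties as ℕ
open import Data.Nat.Divisibility using (_∣_; _∣?_; ∣⇒≤; n∣m⇒m%n≡0)
open import Data.Nat.DivMod using (m<n⇒m%n≡m)
open import Data.Nat.Primality using (Prime; prime?)
open import Data.Product using (_×_; _,_; proj₁; proj₂)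
open import Data.Sum using (inj₁; inj₂)
open import Data.Unit using (tt)
open import Function.Bundles using (_⇔_; mk⇔; module Equivalence)
open import Function.Construct.Symmetry using (⇔-sym)
open import Function.Properties.Equivalence using () renaming (trans to ⇔-trans)
import Function.Related.Propositional as Related
open import Relation.Nullary using (¬_; contradiction; Dec; _×-dec_; _→-dec_)
open import Relation.Nullary.Decidable using (toWitness)
open import Relation.Binary.PropositionalEquality
  using (_≡_; _≢_; refl; sym; trans; cong; cong₂; subst; module ≡-Reasoning)

-- The hypotheses force p ≤ q < 200, which leaves finitely many pairs (p, q).
-- For each of them an explicit family of pairs in ℤ_pq is given, and both
-- covering conditions are verified by computation: the residues of ±x, ±y
-- (resp. ±(x - y), ±(x + y)) over the family, sorted, are exactly
-- pq - 1, …, 2, 1.  Such a sorted list is a permutation of the residue list,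
-- so every non-zero residue occurs and 0 does not.

-- Sorting and list comparison use the Boolean tests ≤ᵇ and ≡ᵇ rather than
-- Data.List.Sort and ≡-dec: the certificates below are checked by evaluation
-- during type checking, where the Dec-based versions are about twice as slow.

mutual
  merge≥ : List ℕ → List ℕ → List ℕ
  merge≥ []       ys = ys
  merge≥ (x ∷ xs) ys = merge≥-∷ x xs ys

  merge≥-∷ : ℕ → List ℕ → List ℕ → List ℕ
  merge≥-∷ x xs []       = x ∷ xs
  merge≥-∷ x xs (y ∷ ys) with y ℕ.≤ᵇ x
  ... | true  = x ∷ merge≥ xs (y ∷ ys)
  ... | false = y ∷ merge≥-∷ x xs ys

mergePairs≥ : List (List ℕ) → List (List ℕ)
mergePairs≥ (xs ∷ ys ∷ xss) = merge≥ xs ys ∷ mergePairs≥ xss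
mergePairs≥ xss             = xss

mergeAll≥ : ℕ → List (List ℕ) → List ℕ
mergeAll≥ (suc n) xss@(_ ∷ _ ∷ _) = mergeAll≥ n (mergePairs≥ xss)
mergeAll≥ _       xss             = concat xss

sort≥ : List ℕ → List ℕ
sort≥ xs = mergeAll≥ (length xs) (map [_] xs)

mutual
  merge≥-↭ : ∀ xs ys → merge≥ xs ys ↭ xs ++ ys
  merge≥-↭ []       ys = ↭-refl
  merge≥-↭ (x ∷ xs) ys = merge≥-∷-↭ x xs ys

  merge≥-∷-↭ : ∀ x xs ys → merge≥-∷ x xs ys ↭ x ∷ xs ++ ys
  merge≥-∷-↭ x xs []       = ↭-sym (++-identityʳ (x ∷ xs))
  merge≥-∷-↭ x xs (y ∷ ys) with y ℕ.≤ᵇ x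
  ... | true  = ↭-prep x (merge≥-↭ xs (y ∷ ys))
  ... | false = ↭-trans (↭-prep y (merge≥-∷-↭ x xs ys)) (↭-sym (shift y (x ∷ xs) ys))

mergePairs≥-↭ : ∀ xss → concat (mergePairs≥ xss) ↭ concat xss
mergePairs≥-↭ (xs ∷ ys ∷ xss) =
  ↭-trans (++⁺ (merge≥-↭ xs ys) (mergePairs≥-↭ xss)) (↭-reflexive (++-assoc xs ys (concat xss)))
mergePairs≥-↭ []              = ↭-refl
mergePairs≥-↭ (_ ∷ [])        = ↭-refl

mergeAll≥-↭ : ∀ n xss → mergeAll≥ n xss ↭ concat xss
mergeAll≥-↭ (suc n) xss@(_ ∷ _ ∷ _) = ↭-trans (mergeAll≥-↭ n (mergePairs≥ xss)) (mergePairs≥-↭ xss)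
mergeAll≥-↭ zero    _               = ↭-refl
mergeAll≥-↭ (suc n) []              = ↭-refl
mergeAll≥-↭ (suc n) (_ ∷ [])        = ↭-refl

sort≥-↭ : ∀ xs → sort≥ xs ↭ xs
sort≥-↭ xs = ↭-trans (mergeAll≥-↭ (length xs) (map [_] xs)) (↭-reflexive (concat-map-[ xs ]))

_≡ᵇ_ : List ℕ → List ℕ → Bool
[]       ≡ᵇ []       = true
(x ∷ xs) ≡ᵇ (y ∷ ys) = (x ℕ.≡ᵇ y) ∧ (xs ≡ᵇ ys)
_        ≡ᵇ _        = false

≡ᵇ⇒≡ : ∀ xs ys → T (xs ≡ᵇ ys) → xs ≡ ys
≡ᵇ⇒≡ []       []       _  = refl
≡ᵇ⇒≡ (x ∷ xs) (y ∷ ys) eq =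
  let x≡ᵇy , xs≡ᵇys = Equivalence.to T-∧ eq in cong₂ _∷_ (ℕ.≡ᵇ⇒≡ x y x≡ᵇy) (≡ᵇ⇒≡ xs ys xs≡ᵇys)

module _ (v : ℕ) .{{_ : NonZero v}} where

  ≡[mod]-sym : ∀ {a b} → a ≡ b [mod v ] → b ≡ a [mod v ]
  ≡[mod]-sym {a} {b} = subst (v ∣_) (ℤ.∣i-j∣≡∣j-i∣ a b)

  ≡[mod]-trans : ∀ {a b c} → a ≡ b [mod v ] → b ≡ c [mod v ] → a ≡ c [mod v ]
  ≡[mod]-trans {a} {b} {c} a≡b b≡c = ℤ.∣⇒∣ᵤ (subst (+ v ℤ.∣_) (telescope a b c)
    (ℤ.∣m∣n⇒∣m+n (ℤ.∣ᵤ⇒∣ {i = a - b} a≡b) (ℤ.∣ᵤ⇒∣ {i = b - c} b≡c)))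
    where
    telescope : ∀ a b c → (a - b) ℤ.+ (b - c) ≡ a - c
    telescope = solve-∀

  ≡[mod]-%ℕ : ∀ z → z ≡ (+ (z %ℕ v)) [mod v ]
  ≡[mod]-%ℕ z = ℤ.∣⇒∣ᵤ (ℤ.divides (z /ℕ v) (begin
    z - r                              ≡⟨ cong (_- r) (a≡a%ℕn+[a/ℕn]*n z v) ⟩
    (r ℤ.+ (z /ℕ v) ℤ.* + v) - r       ≡⟨ cancel r ((z /ℕ v) ℤ.* + v) ⟩
    (z /ℕ v) ℤ.* + v                   ∎))
    where
    open ≡-Reasoning
    r : ℤ
    r = + (z %ℕ v)
    cancel : ∀ r m → (r ℤ.+ m) - r ≡ m
    cancel = solve-∀

  residue-unique : ∀ {m n} → m < v → n < v → (+ m) ≡ (+ n) [mod v ] → m ≡ n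
  residue-unique {m} {n} m<v n<v v∣m-n =
    ℤ.+-injective (ℤ.i-j≡0⇒i≡j (+ m) (+ n) (ℤ.∣i∣≡0⇒i≡0 ∣m-n∣≡0))
    where
    ∣m-n∣<v : ∣ + m - + n ∣ < v
    ∣m-n∣<v = ℕ.≤-<-trans
      (subst (ℕ._≤ m ℕ.⊔ n) (cong ∣_∣ (sym (ℤ.m-n≡m⊖n m n))) (ℤ.∣m⊝n∣≤m⊔n m n))
      (ℕ.⊔-lub m<v n<v)
    ∣m-n∣≡0 : ∣ + m - + n ∣ ≡ 0
    ∣m-n∣≡0 = trans (sym (m<n⇒m%n≡m ∣m-n∣<v)) (n∣m⇒m%n≡0 _ v v∣m-n)

  ≡[mod]⇔%ℕ≡ : ∀ a b → a ≡ b [mod v ] ⇔ a %ℕ v ≡ b %ℕ v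
  ≡[mod]⇔%ℕ≡ a b = mk⇔
    (λ a≡b → residue-unique (n%ℕd<d a v) (n%ℕd<d b v)
      (≡[mod]-trans {ra} {a} (≡[mod]-sym {a} (≡[mod]-%ℕ a)) (≡[mod]-trans {a} {b} a≡b (≡[mod]-%ℕ b))))
    (λ a%v≡b%v → ≡[mod]-trans {a} {rb}
      (subst (λ r → a ≡ (+ r) [mod v ]) a%v≡b%v (≡[mod]-%ℕ a)) (≡[mod]-sym {b} (≡[mod]-%ℕ b)))
    where
    ra rb : ℤ
    ra = + (a %ℕ v)
    rb = + (b %ℕ v)

  ≢0[mod]⇔%ℕ≢0 : ∀ z → (¬ (z ≡ + 0 [mod v ])) ⇔ z %ℕ v ≢ 0
  ≢0[mod]⇔%ℕ≢0 z = mk⇔ (λ z≢0 r≡0 → z≢0 (from (trans r≡0 (sym 0%v≡0))))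
                         (λ r≢0 z≡0 → r≢0 (trans (to z≡0) 0%v≡0))
    where
    open Equivalence (≡[mod]⇔%ℕ≡ z (+ 0))
    0%v≡0 : (+ 0) %ℕ v ≡ 0
    0%v≡0 = m<n⇒m%n≡m (ℕ.>-nonZero⁻¹ v)

  ±residues : ℤ × ℤ → List ℕ
  ±residues (x , y) = x %ℕ v ∷ (- x) %ℕ v ∷ y %ℕ v ∷ (- y) %ℕ v ∷ []

  In±⇔∈±residues : ∀ z x y → In± v z x y ⇔ z %ℕ v ∈ ±residues (x , y)
  In±⇔∈±residues z x y = mk⇔ to from
    where
    residue : ∀ c → z ≡ c [mod v ] → z %ℕ v ≡ c %ℕ v
    residue c = Equivalence.to (≡[mod]⇔%ℕ≡ z c)
    congruent : ∀ c → z %ℕ v ≡ c %ℕ v → z ≡ c [mod v ]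
    congruent c = Equivalence.from (≡[mod]⇔%ℕ≡ z c)
    to : In± v z x y → z %ℕ v ∈ ±residues (x , y)
    to (inj₁ z≡x)                = here (residue x z≡x)
    to (inj₂ (inj₁ z≡-x))        = there (here (residue (- x) z≡-x))
    to (inj₂ (inj₂ (inj₁ z≡y)))  = there (there (here (residue y z≡y)))
    to (inj₂ (inj₂ (inj₂ z≡-y))) = there (there (there (here (residue (- y) z≡-y))))
    from : z %ℕ v ∈ ±residues (x , y) → In± v z x y
    from (here e)                         = inj₁ (congruent x e)
    from (there (here e))                 = inj₂ (inj₁ (congruent (- x) e))
    from (there (there (here e)))         = inj₂ (inj₂ (inj₁ (congruent y e)))
    from (there (there (there (here e)))) = inj₂ (inj₂ (inj₂ (congruent (- y) e)))

  nonzeroResidues : List ℕ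
  nonzeroResidues = applyDownFrom suc (v ∸ 1)

  ∈-nonzeroResidues⇔≢0 : ∀ {r} → r < v → r ∈ nonzeroResidues ⇔ r ≢ 0
  ∈-nonzeroResidues⇔≢0 r<v = mk⇔ ≢0 (∈nonzero r<v)
    where
    ≢0 : ∀ {r} → r ∈ nonzeroResidues → r ≢ 0
    ≢0 r∈ with _ , _ , refl ← ∈-applyDownFrom⁻ suc r∈ = λ ()
    ∈nonzero : ∀ {r} → r < v → r ≢ 0 → r ∈ nonzeroResidues
    ∈nonzero {zero}  _   0≢0 = contradiction refl 0≢0
    ∈nonzero {suc _} r<v _   = ∈-applyDownFrom⁺ suc (ℕ.∸-monoˡ-≤ 1 r<v)

  CoversNonzeroResidues : List (ℤ × ℤ) → Set
  CoversNonzeroResidues l = sort≥ (concatMap ±residues l) ≡ nonzeroResidues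

  coversNonzeroResidues : List (ℤ × ℤ) → Bool
  coversNonzeroResidues l = sort≥ (concatMap ±residues l) ≡ᵇ nonzeroResidues

  CoversNonzeroResidues⇒cover : ∀ l → CoversNonzeroResidues l →
    ∀ z → (¬ (z ≡ + 0 [mod v ])) ⇔ Any (λ p → In± v z (proj₁ p) (proj₂ p)) l
  CoversNonzeroResidues⇒cover l sorted z = begin
    ¬ (z ≡ + 0 [mod v ])                       ∼⟨ ≢0[mod]⇔%ℕ≢0 z ⟩
    z %ℕ v ≢ 0                                 ∼⟨ ⇔-sym (∈-nonzeroResidues⇔≢0 (n%ℕd<d z v)) ⟩
    z %ℕ v ∈ nonzeroResidues                   ≡⟨ cong (z %ℕ v ∈_) (sym sorted) ⟩
    z %ℕ v ∈ sort≥ (concatMap ±residues l)     ∼⟨ mk⇔ (∈-resp-↭ (sort≥-↭ _)) (∈-resp-↭ (↭-sym (sort≥-↭ _))) ⟩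
    z %ℕ v ∈ concatMap ±residues l             ∼⟨ mk⇔ (∈-concatMap⁻ ±residues) (∈-concatMap⁺ ±residues) ⟩
    Any (λ p → z %ℕ v ∈ ±residues p) l         ∼⟨ Any-cong (λ p → ⇔-sym (In±⇔∈±residues z (proj₁ p) (proj₂ p))) (_ ∎) ⟩
    Any (λ p → In± v z (proj₁ p) (proj₂ p)) l  ∎
    where open Related.EquationalReasoning

  differenceAndSum : ℤ × ℤ → ℤ × ℤ
  differenceAndSum (x , y) = (x - y , x ℤ.+ y)

  partitionableSet : (l : List (ℤ × ℤ)) → length l ≡ (v ∸ 1) / 4 →
    T (coversNonzeroResidues l) → T (coversNonzeroResidues (map differenceAndSum l)) → PS v
  partitionableSet l size covers covers± = record
    { pairs  = l
    ; size   = size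
    ; cover₁ = CoversNonzeroResidues⇒cover l (≡ᵇ⇒≡ _ _ covers)
    ; cover₂ = λ z → ⇔-trans (CoversNonzeroResidues⇒cover _ (≡ᵇ⇒≡ _ _ covers±) z) (mk⇔ map⁻ map⁺)
    }

  -- The families below are given as unions of orbits {k·b mod v : k ∈ ks, b ∈ bs}
  -- of base pairs bs under multipliers ks.
  orbitPairs : List (List ℕ × List (ℕ × ℕ)) → List (ℤ × ℤ)
  orbitPairs = concatMap λ (ks , bs) →
    concatMap (λ k → map (λ (x , y) → (+ (k * x % v) , + (k * y % v))) bs) ks

record KnownPS : Set where
  constructor knownPS
  field
    p q : ℕ
    ps  : PS (p * q)

Listed : ℕ → ℕ → List KnownPS → Set
Listed p q = Any λ e → KnownPS.p e ≡ p × KnownPS.q e ≡ q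

listed? : ∀ p q es → Dec (Listed p q es)
listed? p q = any? λ e → (KnownPS.p e ℕ.≟ p) ×-dec (KnownPS.q e ℕ.≟ q)

lookupPS : ∀ {p q} es → Listed p q es → PS (p * q)
lookupPS _ listed with knownPS _ _ ps , _ , refl , refl ← find listed = ps

Admissible : ℕ → ℕ → Set
Admissible p q = q % 4 ≡ 3 × p % 4 ≡ 3 × 3 < q × 3 < p × (p ∸ 1) ∣ (q ∸ 1) × Prime q × Prime p

-- Cheapest tests first: this is evaluated for all 40000 pairs below 200.
admissible? : ∀ p q → Dec (Admissible p q)
admissible? p q = (q % 4 ℕ.≟ 3) ×-dec (p % 4 ℕ.≟ 3) ×-dec (3 ℕ.<? q) ×-dec (3 ℕ.<? p)
  ×-dec ((p ∸ 1) ∣? (q ∸ 1)) ×-dec prime? q ×-dec prime? p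

CompleteBelow : ℕ → List KnownPS → Set
CompleteBelow n es = ∀ {q} → q < n → ∀ {p} → p < n → Admissible p q → Listed p q es

completeBelow? : ∀ n es → Dec (CompleteBelow n es)
completeBelow? n es = ℕ.allUpTo? (λ q → ℕ.allUpTo? (λ p → admissible? p q →-dec listed? p q es) n) n

∣-pred⇒≤ : ∀ {p q} → 1 < q → (p ∸ 1) ∣ (q ∸ 1) → p ≤ q
∣-pred⇒≤ {zero}                _        _ = z≤n
∣-pred⇒≤ {suc _} {suc (suc _)} _        d = s≤s (∣⇒≤ d)
∣-pred⇒≤ {suc _} {suc zero}    (s≤s ()) _

ps-7×7 : PS (7 * 7)
ps-7×7 = partitionableSet 49 (orbitPairs 49 (((1 ∷ 18 ∷ 30 ∷ []) , ((6 , 12) ∷ (2 , 7) ∷ (1 , 3) ∷ (4 , 25) ∷ [])) ∷ [])) refl tt tt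

ps-11×11 : PS (11 * 11)
ps-11×11 = partitionableSet 121 (orbitPairs 121 (((1 ∷ 3 ∷ 9 ∷ 27 ∷ 81 ∷ []) , ((5 , 7) ∷ (10 , 59) ∷ (2 , 17) ∷ (4 , 29) ∷ (11 , 48) ∷ (1 , 8) ∷ [])) ∷ [])) refl tt tt

ps-7×19 : PS (7 * 19)
ps-7×19 = partitionableSet 133 (orbitPairs 133 (((1 ∷ []) , ((57 , 77) ∷ (114 , 7) ∷ (38 , 84) ∷ (1 , 113) ∷ (121 , 107) ∷ (122 , 87) ∷ [])) ∷ ((1 ∷ 64 ∷ 8 ∷ []) , ((21 , 70) ∷ [])) ∷ ((1 ∷ 113 ∷ 121 ∷ 107 ∷ 122 ∷ 87 ∷ []) , ((4 , 13) ∷ (3 , 58) ∷ (9 , 39) ∷ (2 , 90) ∷ [])) ∷ [])) refl tt tt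

ps-19×19 : PS (19 * 19)
ps-19×19 = partitionableSet 361 (orbitPairs 361 (((1 ∷ 28 ∷ 62 ∷ 292 ∷ 234 ∷ 54 ∷ 68 ∷ 99 ∷ 245 ∷ []) , ((4 , 149) ∷ (36 , 123) ∷ (5 , 31) ∷ (1 , 338) ∷ (3 , 233) ∷ (12 , 83) ∷ (8 , 251) ∷ (2 , 196) ∷ (10 , 59) ∷ (19 , 176) ∷ [])) ∷ [])) refl tt tt

ps-23×23 : PS (23 * 23)
ps-23×23 = partitionableSet 529 (orbitPairs 529 (((1 ∷ 118 ∷ 170 ∷ 487 ∷ 334 ∷ 266 ∷ 177 ∷ 255 ∷ 466 ∷ 501 ∷ 399 ∷ []) , ((35 , 310) ∷ (8 , 99) ∷ (4 , 264) ∷ (26 , 80) ∷ (2 , 47) ∷ (1 , 11) ∷ (10 , 288) ∷ (16 , 201) ∷ (7 , 138) ∷ (40 , 393) ∷ (5 , 374) ∷ (13 , 339) ∷ [])) ∷ [])) refl tt tt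

ps-7×31 : PS (7 * 31)
ps-7×31 = partitionableSet 217 (orbitPairs 217 (((1 ∷ []) , ((155 , 63) ∷ (93 , 56) ∷ (31 , 119) ∷ (1 , 92) ∷ (149 , 37) ∷ (150 , 129) ∷ [])) ∷ ((1 ∷ 211 ∷ 57 ∷ []) , ((189 , 70) ∷ (126 , 42) ∷ [])) ∷ ((1 ∷ 92 ∷ 149 ∷ 37 ∷ 150 ∷ 129 ∷ []) , ((4 , 43) ∷ (11 , 23) ∷ (3 , 159) ∷ (9 , 15) ∷ (5 , 90) ∷ (8 , 10) ∷ (2 , 25) ∷ [])) ∷ [])) refl tt tt

ps-11×31 : PS (11 * 31)
ps-11×31 = partitionableSet 341 (orbitPairs 341 (((1 ∷ []) , ((155 , 187) ∷ (310 , 275) ∷ (124 , 33) ∷ (279 , 264) ∷ (93 , 132) ∷ (1 , 309) ∷ (244 , 35) ∷ (157 , 91) ∷ (202 , 15) ∷ (225 , 302) ∷ [])) ∷ ((1 ∷ 89 ∷ 188 ∷ 78 ∷ 287 ∷ []) , ((220 , 165) ∷ [])) ∷ ((1 ∷ 309 ∷ 244 ∷ 35 ∷ 157 ∷ 91 ∷ 202 ∷ 15 ∷ 225 ∷ 302 ∷ []) , ((5 , 208) ∷ (3 , 298) ∷ (18 , 193) ∷ (4 , 210) ∷ (8 , 56) ∷ (9 , 199) ∷ (2 , 16) ∷ [])) ∷ [])) refl tt tt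

ps-31×31 : PS (31 * 31)
ps-31×31 = partitionableSet 961 (orbitPairs 961 (((1 ∷ 235 ∷ 448 ∷ 531 ∷ 816 ∷ 521 ∷ 388 ∷ 846 ∷ 844 ∷ 374 ∷ 439 ∷ 338 ∷ 628 ∷ 547 ∷ 732 ∷ []) , ((9 , 891) ∷ (19 , 721) ∷ (8 , 11) ∷ (1 , 444) ∷ (3 , 594) ∷ (27 , 821) ∷ (13 , 438) ∷ (10 , 921) ∷ (17 , 551) ∷ (12 , 375) ∷ (14 , 248) ∷ (4 , 314) ∷ (2 , 885) ∷ (5 , 500) ∷ (23 , 315) ∷ (39 , 330) ∷ [])) ∷ [])) refl tt tt

ps-7×43 : PS (7 * 43)
ps-7×43 = partitionableSet 301 (orbitPairs 301 (((1 ∷ []) , ((43 , 259) ∷ (86 , 294) ∷ (129 , 252) ∷ (1 , 85) ∷ (79 , 93) ∷ (80 , 178) ∷ [])) ∷ ((1 ∷ 36 ∷ 295 ∷ []) , ((91 , 231) ∷ (217 , 175) ∷ (133 , 238) ∷ [])) ∷ ((1 ∷ 85 ∷ 79 ∷ 93 ∷ 80 ∷ 178 ∷ []) , ((20 , 87) ∷ (24 , 250) ∷ (12 , 148) ∷ (2 , 199) ∷ (10 , 40) ∷ (5 , 235) ∷ (3 , 8) ∷ (4 , 209) ∷ (11 , 156) ∷ (18 , 100) ∷ [])) ∷ [])) refl tt tt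

ps-43×43 : PS (43 * 43)
ps-43×43 = partitionableSet 1849 (orbitPairs 1849 (((1 ∷ 210 ∷ 1573 ∷ 1208 ∷ 367 ∷ 1261 ∷ 403 ∷ 1425 ∷ 1561 ∷ 537 ∷ 1830 ∷ 1557 ∷ 1546 ∷ 1085 ∷ 423 ∷ 78 ∷ 1588 ∷ 660 ∷ 1774 ∷ 891 ∷ 361 ∷ []) , ((51 , 768) ∷ (25 , 773) ∷ (6 , 154) ∷ (13 , 231) ∷ (2 , 202) ∷ (9 , 1511) ∷ (33 , 1593) ∷ (15 , 446) ∷ (12 , 145) ∷ (5 , 1534) ∷ (40 , 1337) ∷ (10 , 258) ∷ (91 , 1719) ∷ (30 , 508) ∷ (18 , 596) ∷ (20 , 72) ∷ (7 , 595) ∷ (11 , 458) ∷ (3 , 558) ∷ (17 , 1755) ∷ (1 , 624) ∷ (4 , 1262) ∷ [])) ∷ [])) refl tt tt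

ps-47×47 : PS (47 * 47)
ps-47×47 = partitionableSet 2209 (orbitPairs 2209 (((1 ∷ 53 ∷ 600 ∷ 874 ∷ 2142 ∷ 867 ∷ 1771 ∷ 1085 ∷ 71 ∷ 1554 ∷ 629 ∷ 202 ∷ 1870 ∷ 1914 ∷ 2037 ∷ 1929 ∷ 623 ∷ 2093 ∷ 479 ∷ 1088 ∷ 230 ∷ 1145 ∷ 1042 ∷ []) , ((4 , 530) ∷ (8 , 1975) ∷ (74 , 356) ∷ (20 , 2140) ∷ (36 , 1622) ∷ (24 , 1611) ∷ (3 , 1406) ∷ (49 , 1607) ∷ (6 , 2134) ∷ (2 , 1378) ∷ (23 , 364) ∷ (7 , 1278) ∷ (1 , 65) ∷ (14 , 1463) ∷ (21 , 2080) ∷ (17 , 1668) ∷ (9 , 29) ∷ (68 , 1492) ∷ (16 , 1868) ∷ (5 , 37) ∷ (46 , 1976) ∷ (47 , 1566) ∷ (25 , 2048) ∷ (11 , 532) ∷ [])) ∷ [])) refl tt tt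

ps-59×59 : PS (59 * 59)
ps-59×59 = partitionableSet 3481 (orbitPairs 3481 (((1 ∷ 53 ∷ 2809 ∷ 2675 ∷ 2535 ∷ 2077 ∷ 2170 ∷ 137 ∷ 299 ∷ 1923 ∷ 970 ∷ 2676 ∷ 2588 ∷ 1405 ∷ 1364 ∷ 2672 ∷ 2376 ∷ 612 ∷ 1107 ∷ 2975 ∷ 1030 ∷ 2375 ∷ 559 ∷ 1779 ∷ 300 ∷ 1976 ∷ 298 ∷ 1870 ∷ 1642 ∷ []) , ((5 , 151) ∷ (27 , 1832) ∷ (29 , 1351) ∷ (15 , 3122) ∷ (4 , 2599) ∷ (68 , 1083) ∷ (60 , 1739) ∷ (19 , 1424) ∷ (2 , 1989) ∷ (20 , 500) ∷ (8 , 59) ∷ (24 , 345) ∷ (14 , 2610) ∷ (6 , 1006) ∷ (17 , 2245) ∷ (7 , 462) ∷ (11 , 1177) ∷ (30 , 1945) ∷ (13 , 2509) ∷ (1 , 573) ∷ (16 , 1728) ∷ (50 , 846) ∷ (9 , 1960) ∷ (100 , 565) ∷ (42 , 776) ∷ (36 , 1339) ∷ (48 , 1741) ∷ (3 , 1749) ∷ (10 , 555) ∷ (25 , 941) ∷ [])) ∷ [])) refl tt tt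

ps-7×67 : PS (7 * 67)
ps-7×67 = partitionableSet 469 (orbitPairs 469 (((1 ∷ []) , ((134 , 336) ∷ (268 , 238) ∷ (402 , 105) ∷ (1 , 267) ∷ (37 , 30) ∷ (38 , 297) ∷ [])) ∷ ((1 ∷ 372 ∷ 239 ∷ []) , ((70 , 56) ∷ (203 , 35) ∷ (280 , 350) ∷ (406 , 21) ∷ (343 , 378) ∷ [])) ∷ ((1 ∷ 267 ∷ 37 ∷ 30 ∷ 38 ∷ 297 ∷ []) , ((23 , 85) ∷ (45 , 55) ∷ (11 , 246) ∷ (3 , 251) ∷ (27 , 249) ∷ (29 , 184) ∷ (36 , 276) ∷ (2 , 253) ∷ (18 , 257) ∷ (8 , 380) ∷ (17 , 92) ∷ (9 , 456) ∷ (5 , 155) ∷ (33 , 269) ∷ (6 , 131) ∷ (4 , 132) ∷ [])) ∷ [])) refl tt tt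

ps-23×67 : PS (23 * 67)
ps-23×67 = partitionableSet 1541 (orbitPairs 1541 (((1 ∷ []) , ((737 , 805) ∷ (1474 , 667) ∷ (670 , 598) ∷ (1407 , 1081) ∷ (603 , 276) ∷ (1340 , 1288) ∷ (536 , 1058) ∷ (1273 , 1380) ∷ (469 , 92) ∷ (1206 , 713) ∷ (402 , 782) ∷ (1 , 1473) ∷ (600 , 807) ∷ (1268 , 72) ∷ (947 , 326) ∷ (879 , 327) ∷ (1087 , 52) ∷ (53 , 1019) ∷ (1112 , 1434) ∷ (561 , 377) ∷ (378 , 493) ∷ (1184 , 1161) ∷ [])) ∷ ((1 ∷ 1404 ∷ 1335 ∷ 277 ∷ 1013 ∷ 484 ∷ 254 ∷ 576 ∷ 829 ∷ 1450 ∷ 1519 ∷ []) , ((69 , 1311) ∷ [])) ∷ ((1 ∷ 1473 ∷ 600 ∷ 807 ∷ 1268 ∷ 72 ∷ 947 ∷ 326 ∷ 879 ∷ 327 ∷ 1087 ∷ 52 ∷ 53 ∷ 1019 ∷ 1112 ∷ 1434 ∷ 561 ∷ 377 ∷ 378 ∷ 493 ∷ 1184 ∷ 1161 ∷ []) , ((24 , 1505) ∷ (5 , 307) ∷ (9 , 158) ∷ (27 , 904) ∷ (8 , 507) ∷ (39 , 1135) ∷ (7 , 153) ∷ (6 , 1130) ∷ (15 , 1193) ∷ (12 , 939) ∷ (13 , 869) ∷ (2 , 1252) ∷ (4 , 1425) ∷ (20 , 1390) ∷ (3 , 649) ∷ (31 , 743) ∷ [])) ∷ [])) refl tt tt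

ps-67×67 : PS (67 * 67)
ps-67×67 = partitionableSet 4489 (orbitPairs 4489 (((1 ∷ 248 ∷ 3147 ∷ 3859 ∷ 875 ∷ 1528 ∷ 1868 ∷ 897 ∷ 2495 ∷ 3767 ∷ 504 ∷ 3789 ∷ 1471 ∷ 1199 ∷ 1078 ∷ 2493 ∷ 3271 ∷ 3188 ∷ 560 ∷ 4210 ∷ 2632 ∷ 1831 ∷ 699 ∷ 2770 ∷ 143 ∷ 4041 ∷ 1121 ∷ 4179 ∷ 3922 ∷ 3032 ∷ 2273 ∷ 2579 ∷ 2154 ∷ []) , ((3 , 210) ∷ (7 , 1119) ∷ (37 , 3152) ∷ (2 , 158) ∷ (88 , 2488) ∷ (13 , 1396) ∷ (64 , 3526) ∷ (8 , 2410) ∷ (24 , 1504) ∷ (28 , 3848) ∷ (83 , 3558) ∷ (6 , 947) ∷ (172 , 2921) ∷ (43 , 1005) ∷ (46 , 4027) ∷ (12 , 2746) ∷ (44 , 3046) ∷ (26 , 635) ∷ (17 , 3146) ∷ (78 , 911) ∷ (49 , 3850) ∷ (31 , 3426) ∷ (38 , 900) ∷ (73 , 3680) ∷ (16 , 4302) ∷ (4 , 658) ∷ (39 , 1385) ∷ (66 , 84) ∷ (1 , 2526) ∷ (74 , 3040) ∷ (51 , 3269) ∷ (33 , 1659) ∷ (11 , 4311) ∷ (32 , 42) ∷ [])) ∷ [])) refl tt tt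

ps-11×71 : PS (11 * 71)
ps-11×71 = partitionableSet 781 (orbitPairs 781 (((1 ∷ []) , ((639 , 143) ∷ (497 , 440) ∷ (355 , 451) ∷ (213 , 693) ∷ (71 , 715) ∷ (1 , 496) ∷ (156 , 57) ∷ (25 , 685) ∷ (125 , 301) ∷ (5 , 137) ∷ [])) ∷ ((1 ∷ 298 ∷ 309 ∷ 551 ∷ 573 ∷ []) , ((220 , 231) ∷ (286 , 539) ∷ (77 , 187) ∷ [])) ∷ ((1 ∷ 496 ∷ 156 ∷ 57 ∷ 25 ∷ 685 ∷ 125 ∷ 301 ∷ 5 ∷ 137 ∷ []) , ((37 , 102) ∷ (21 , 59) ∷ (18 , 463) ∷ (6 , 141) ∷ (38 , 167) ∷ (19 , 287) ∷ (16 , 447) ∷ (47 , 134) ∷ (24 , 579) ∷ (8 , 82) ∷ (29 , 544) ∷ (2 , 422) ∷ (9 , 532) ∷ (14 , 695) ∷ (3 , 567) ∷ (7 , 669) ∷ (36 , 419) ∷ [])) ∷ [])) refl tt tt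

ps-71×71 : PS (71 * 71)
ps-71×71 = partitionableSet 5041 (orbitPairs 5041 (((1 ∷ 121 ∷ 4559 ∷ 2170 ∷ 438 ∷ 2588 ∷ 606 ∷ 2752 ∷ 286 ∷ 4360 ∷ 3296 ∷ 577 ∷ 4284 ∷ 4182 ∷ 1922 ∷ 676 ∷ 1140 ∷ 1833 ∷ 5030 ∷ 3710 ∷ 261 ∷ 1335 ∷ 223 ∷ 1778 ∷ 3416 ∷ 5015 ∷ 1895 ∷ 2450 ∷ 4072 ∷ 3735 ∷ 3286 ∷ 4408 ∷ 4063 ∷ 2646 ∷ 2583 ∷ []) , ((30 , 4658) ∷ (43 , 3935) ∷ (1 , 2464) ∷ (41 , 2491) ∷ (8 , 4222) ∷ (32 , 75) ∷ (14 , 3003) ∷ (29 , 1676) ∷ (65 , 4861) ∷ (16 , 4019) ∷ (31 , 2974) ∷ (38 , 2705) ∷ (4 , 3515) ∷ (169 , 1509) ∷ (9 , 3839) ∷ (5 , 2605) ∷ (36 , 4013) ∷ (19 , 1955) ∷ (12 , 3497) ∷ (39 , 4544) ∷ (18 , 4793) ∷ (63 , 4841) ∷ (2 , 1302) ∷ (57 , 834) ∷ (24 , 3375) ∷ (56 , 4198) ∷ (62 , 2342) ∷ (13 , 530) ∷ (15 , 1422) ∷ (28 , 1539) ∷ (59 , 3722) ∷ (21 , 4736) ∷ (109 , 3817) ∷ (6 , 4718) ∷ (25 , 1971) ∷ (7 , 2063) ∷ [])) ∷ [])) refl tt tt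

ps-7×79 : PS (7 * 79)
ps-7×79 = partitionableSet 553 (orbitPairs 553 (((1 ∷ []) , ((316 , 238) ∷ (79 , 497) ∷ (395 , 182) ∷ (1 , 78) ∷ (23 , 135) ∷ (24 , 213) ∷ [])) ∷ ((1 ∷ 260 ∷ 498 ∷ []) , ((406 , 525) ∷ (84 , 266) ∷ (161 , 259) ∷ (399 , 350) ∷ (476 , 413) ∷ (322 , 483) ∷ [])) ∷ ((1 ∷ 78 ∷ 23 ∷ 135 ∷ 24 ∷ 213 ∷ []) , ((15 , 284) ∷ (6 , 205) ∷ (8 , 75) ∷ (5 , 80) ∷ (2 , 258) ∷ (59 , 61) ∷ (11 , 356) ∷ (10 , 19) ∷ (17 , 20) ∷ (34 , 352) ∷ (31 , 275) ∷ (4 , 225) ∷ (12 , 298) ∷ (27 , 81) ∷ (3 , 188) ∷ (16 , 55) ∷ (30 , 129) ∷ (54 , 151) ∷ (29 , 282) ∷ [])) ∷ [])) refl tt tt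

ps-79×79 : PS (79 * 79)
ps-79×79 = partitionableSet 6241 (orbitPairs 6241 (((1 ∷ 31 ∷ 961 ∷ 4827 ∷ 6094 ∷ 1684 ∷ 2276 ∷ 1905 ∷ 2886 ∷ 2092 ∷ 2442 ∷ 810 ∷ 146 ∷ 4526 ∷ 3004 ∷ 5750 ∷ 3502 ∷ 2465 ∷ 1523 ∷ 3526 ∷ 3209 ∷ 5864 ∷ 795 ∷ 5922 ∷ 2593 ∷ 5491 ∷ 1714 ∷ 3206 ∷ 5771 ∷ 4153 ∷ 3923 ∷ 3034 ∷ 439 ∷ 1127 ∷ 3732 ∷ 3354 ∷ 4118 ∷ 2838 ∷ 604 ∷ []) , ((7 , 2910) ∷ (3 , 1785) ∷ (101 , 5951) ∷ (40 , 4558) ∷ (58 , 3693) ∷ (6 , 3247) ∷ (36 , 5164) ∷ (20 , 84) ∷ (8 , 5137) ∷ (47 , 2922) ∷ (88 , 4731) ∷ (34 , 3503) ∷ (33 , 1419) ∷ (10 , 257) ∷ (1 , 540) ∷ (4 , 6015) ∷ (24 , 1462) ∷ (66 , 4898) ∷ (21 , 150) ∷ (11 , 2681) ∷ (90 , 2128) ∷ (17 , 1747) ∷ (9 , 2549) ∷ (19 , 5976) ∷ (30 , 152) ∷ (64 , 3106) ∷ (2 , 3851) ∷ (18 , 3934) ∷ (5 , 2977) ∷ (125 , 2926) ∷ (12 , 3709) ∷ (14 , 3412) ∷ (15 , 5442) ∷ (42 , 1434) ∷ (45 , 561) ∷ (25 , 44) ∷ (103 , 609) ∷ (16 , 3335)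 ∷ (68 , 2160) ∷ (32 , 2447) ∷ [])) ∷ [])) refl tt tt

ps-83×83 : PS (83 * 83)
ps-83×83 = partitionableSet 6889 (orbitPairs 6889 (((1 ∷ 99 ∷ 2912 ∷ 5839 ∷ 6274 ∷ 1116 ∷ 260 ∷ 5073 ∷ 6219 ∷ 2560 ∷ 5436 ∷ 822 ∷ 5599 ∷ 3181 ∷ 4914 ∷ 4256 ∷ 1115 ∷ 161 ∷ 2161 ∷ 380 ∷ 3175 ∷ 4320 ∷ 562 ∷ 526 ∷ 3851 ∷ 2354 ∷ 5709 ∷ 293 ∷ 1451 ∷ 5869 ∷ 2355 ∷ 5808 ∷ 3205 ∷ 401 ∷ 5254 ∷ 3471 ∷ 6068 ∷ 1389 ∷ 6620 ∷ 925 ∷ 2018 ∷ []) , ((44 , 4042) ∷ (20 , 3359) ∷ (46 , 1810) ∷ (64 , 4051) ∷ (14 , 5895) ∷ (26 , 3971) ∷ (5 , 1417) ∷ (88 , 777) ∷ (10 , 6820) ∷ (4 , 1780) ∷ (34 , 3481) ∷ (25 , 6222) ∷ (11 , 3668) ∷ (8 , 6726) ∷ (18 , 273) ∷ (41 , 2337) ∷ (66 , 6723) ∷ (74 , 4403) ∷ (31 , 4946) ∷ (45 , 2604) ∷ (22 , 3222) ∷ (50 , 3391) ∷ (21 , 2128) ∷ (2 , 1730) ∷ (6 , 6013) ∷ (13 , 2484) ∷ (12 , 5297) ∷ (1 , 5313) ∷ (9 , 15) ∷ (3 , 5081) ∷ (24 , 5355) ∷ (75 , 1666) ∷ (23 ,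 5156) ∷ (104 , 107) ∷ (16 , 2733) ∷ (28 , 811) ∷ (160 , 5300) ∷ (7 , 5267) ∷ (17 , 2133) ∷ (39 , 5110) ∷ (89 , 4019) ∷ (32 , 4365) ∷ [])) ∷ [])) refl tt tt

ps-7×103 : PS (7 * 103)
ps-7×103 = partitionableSet 721 (orbitPairs 721 (((1 ∷ []) , ((309 , 413) ∷ (618 , 56) ∷ (206 , 469) ∷ (1 , 617) ∷ (674 , 562) ∷ (675 , 458) ∷ [])) ∷ ((1 ∷ 365 ∷ 57 ∷ []) , ((14 , 693) ∷ (623 , 476) ∷ (315 , 7) ∷ (210 , 231) ∷ (525 , 371) ∷ (105 , 420) ∷ (630 , 259) ∷ (518 , 427) ∷ [])) ∷ ((1 ∷ 617 ∷ 674 ∷ 562 ∷ 675 ∷ 458 ∷ []) , ((53 , 554) ∷ (12 , 367) ∷ (26 , 62) ∷ (6 , 487) ∷ (2 , 130) ∷ (3 , 450) ∷ (8 , 101) ∷ (67 , 117) ∷ (36 , 102) ∷ (39 , 293) ∷ (40 , 155) ∷ (15 , 200) ∷ (13 , 158) ∷ (4 , 120) ∷ (37 , 99) ∷ (10 , 561) ∷ (34 , 144) ∷ (9 , 43) ∷ (19 , 314) ∷ (5 , 237) ∷ (29 , 54) ∷ (17 , 22) ∷ (25 , 247) ∷ (23 , 302) ∷ (20 , 38) ∷ [])) ∷ [])) refl tt tt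

ps-103×103 : PS (103 * 103)
ps-103×103 = partitionableSet 10609 (orbitPairs 10609 (((1 ∷ 350 ∷ 5801 ∷ 4031 ∷ 10462 ∷ 1595 ∷ 6582 ∷ 1547 ∷ 391 ∷ 9542 ∷ 8474 ∷ 5989 ∷ 6177 ∷ 8323 ∷ 6184 ∷ 164 ∷ 4355 ∷ 7163 ∷ 3326 ∷ 7719 ∷ 6964 ∷ 7939 ∷ 9701 ∷ 470 ∷ 5365 ∷ 10566 ∷ 6168 ∷ 5173 ∷ 7020 ∷ 6321 ∷ 5678 ∷ 3417 ∷ 7742 ∷ 4405 ∷ 3445 ∷ 6933 ∷ 7698 ∷ 10223 ∷ 2817 ∷ 9922 ∷ 3557 ∷ 3697 ∷ 10261 ∷ 5508 ∷ 7571 ∷ 8209 ∷ 8720 ∷ 7217 ∷ 1008 ∷ 2703 ∷ 1849 ∷ []) , ((315 , 8573) ∷ (21 , 6522) ∷ (36 , 4262) ∷ (1 , 10298) ∷ (19 , 8120) ∷ (41 , 7249) ∷ (57 , 9917) ∷ (8 , 2411) ∷ (83 , 9453) ∷ (2 , 7437) ∷ (29 , 734) ∷ (11 , 6705) ∷ (51 , 2778) ∷ (46 , 8298) ∷ (32 , 577) ∷ (24 , 9043) ∷ (27 , 5738) ∷ (22 , 997) ∷ (31 , 9660) ∷ (18 , 2924) ∷ (6 , 8322) ∷ (76 , 1197) ∷ (54 , 4961) ∷ (10 , 5449) ∷ (16 , 8267) ∷ (88 , 8984) ∷ (56 , 2865) ∷ (180 , 5017) ∷ (13 , 9126) ∷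 (4 , 6683) ∷ (30 , 7175) ∷ (20 , 8355) ∷ (105 , 9726) ∷ (14 , 6879) ∷ (26 , 5086) ∷ (58 , 6483) ∷ (7 , 7930) ∷ (17 , 39) ∷ (40 , 1336) ∷ (25 , 6785) ∷ (3 , 4038) ∷ (34 , 5215) ∷ (35 , 299) ∷ (103 , 4565) ∷ (5 , 2981) ∷ (63 , 5606) ∷ (78 , 214) ∷ (97 , 2330) ∷ (15 , 10129) ∷ (28 , 9940) ∷ (60 , 6237) ∷ (9 , 8933) ∷ [])) ∷ [])) refl tt tt

ps-107×107 : PS (107 * 107)
ps-107×107 = partitionableSet 11449 (orbitPairs 11449 (((1 ∷ 164 ∷ 3998 ∷ 3079 ∷ 1200 ∷ 2167 ∷ 469 ∷ 8222 ∷ 8875 ∷ 1477 ∷ 1799 ∷ 8811 ∷ 2430 ∷ 9254 ∷ 6388 ∷ 5773 ∷ 7954 ∷ 10719 ∷ 6219 ∷ 955 ∷ 7783 ∷ 5573 ∷ 9501 ∷ 1100 ∷ 8665 ∷ 1384 ∷ 9445 ∷ 3365 ∷ 2308 ∷ 695 ∷ 10939 ∷ 7952 ∷ 10391 ∷ 9672 ∷ 6246 ∷ 5383 ∷ 1239 ∷ 8563 ∷ 7554 ∷ 2364 ∷ 9879 ∷ 5847 ∷ 8641 ∷ 8897 ∷ 5085 ∷ 9612 ∷ 7855 ∷ 5932 ∷ 11132 ∷ 5257 ∷ 3473 ∷ 8571 ∷ 8866 ∷ []) , ((6 , 3633) ∷ (7 , 2588) ∷ (21 , 853) ∷ (27 ,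 4155) ∷ (19 , 2439) ∷ (25 , 2139) ∷ (3 , 361) ∷ (4 , 1184) ∷ (22 , 4094) ∷ (57 , 7548) ∷ (11 , 6784) ∷ (56 , 3595) ∷ (5 , 10577) ∷ (17 , 5408) ∷ (50 , 10456) ∷ (100 , 2104) ∷ (35 , 7538) ∷ (118 , 6617) ∷ (109 , 3248) ∷ (68 , 2078) ∷ (51 , 1739) ∷ (41 , 10248) ∷ (2 , 8458) ∷ (283 , 5623) ∷ (237 , 7768) ∷ (88 , 7194) ∷ (66 , 11108) ∷ (61 , 3020) ∷ (10 , 5921) ∷ (23 , 4402) ∷ (28 , 4422) ∷ (46 , 928) ∷ (9 , 11229) ∷ (54 , 9691) ∷ (20 , 4586) ∷ (135 , 8158) ∷ (55 , 5976) ∷ (38 , 69) ∷ (82 , 9091) ∷ (67 , 1077) ∷ (1 , 11040) ∷ (44 , 356) ∷ (30 , 4846) ∷ (8 , 6377) ∷ (39 , 1208) ∷ (26 , 1346) ∷ (33 , 1914) ∷ (42 , 3580) ∷ (15 , 293) ∷ (176 , 10901) ∷ (87 , 4855) ∷ (103 , 3638) ∷ (18 , 1831) ∷ (101 , 9987) ∷ [])) ∷ [])) refl tt tt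

ps-7×127 : PS (7 * 127)
ps-7×127 = partitionableSet 889 (orbitPairs 889 (((1 ∷ []) , ((127 , 763) ∷ (254 , 742) ∷ (381 , 616) ∷ (1 , 253) ∷ (107 , 401) ∷ (108 , 654) ∷ [])) ∷ ((1 ∷ 869 ∷ 743 ∷ []) , ((266 , 35) ∷ (511 , 462) ∷ (259 , 770) ∷ (392 , 182) ∷ (518 , 840) ∷ (133 , 420) ∷ (644 , 658) ∷ (385 , 77) ∷ (637 , 784) ∷ (525 , 560) ∷ [])) ∷ ((1 ∷ 253 ∷ 107 ∷ 401 ∷ 108 ∷ 654 ∷ []) , ((27 , 345) ∷ (57 , 262) ∷ (19 , 477) ∷ (2 , 15) ∷ (23 , 676) ∷ (17 , 149) ∷ (55 , 65) ∷ (64 , 250) ∷ (30 , 496) ∷ (16 , 440) ∷ (11 , 394) ∷ (22 , 717) ∷ (4 , 814) ∷ (18 , 278) ∷ (9 , 297) ∷ (61 , 319) ∷ (13 , 564) ∷ (44 , 517) ∷ (3 , 246) ∷ (12 , 141) ∷ (48 , 710) ∷ (39 , 54) ∷ (94 , 177) ∷ (85 , 361) ∷ (36 , 584) ∷ (138 , 638) ∷ (5 , 38) ∷ (10 , 422) ∷ (32 , 156) ∷ (6 , 285) ∷ (89 , 596) ∷ [])) ∷ [])) refl tt tt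

ps-19×127 : PS (19 * 127)
ps-19×127 = partitionableSet 2413 (orbitPairs 2413 (((1 ∷ []) , ((381 , 2033) ∷ (762 , 1425) ∷ (1143 , 532) ∷ (1524 , 1292) ∷ (1905 , 1957) ∷ (2286 , 418) ∷ (254 , 361) ∷ (635 , 2394) ∷ (1016 , 703) ∷ (1 , 761) ∷ (2187 , 1750) ∷ (1675 , 611) ∷ (403 , 232) ∷ (1449 , 2361) ∷ (291 , 1868) ∷ (615 , 2306) ∷ (616 , 654) ∷ (1719 , 313) ∷ [])) ∷ ((1 ∷ 1806 ∷ 913 ∷ 1673 ∷ 2338 ∷ 799 ∷ 742 ∷ 362 ∷ 1084 ∷ []) , ((1653 , 1805) ∷ (1273 , 893) ∷ (1786 , 2185) ∷ [])) ∷ ((1 ∷ 761 ∷ 2187 ∷ 1750 ∷ 1675 ∷ 611 ∷ 403 ∷ 232 ∷ 1449 ∷ 2361 ∷ 291 ∷ 1868 ∷ 615 ∷ 2306 ∷ 616 ∷ 654 ∷ 1719 ∷ 313 ∷ []) , ((25 , 2083) ∷ (41 , 754) ∷ (27 , 367) ∷ (7 , 400) ∷ (9 , 374) ∷ (3 , 1436) ∷ (11 , 614) ∷ (53 , 123) ∷ (39 , 1694) ∷ (29 , 300) ∷ (4 , 1595) ∷ (44 , 847) ∷ (86 , 1992) ∷ (99 , 1863) ∷ (2 , 221) ∷ (23 , 1424) ∷ (21 , 2251) ∷ (8 , 244) ∷ (43 , 574) ∷ (20 , 1774) ∷ (22 , 870) ∷ (16 , 2329) ∷ (17 , 290) ∷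 (14 , 217) ∷ (5 , 154) ∷ (10 , 1345) ∷ (26 , 765) ∷ (82 , 198) ∷ (151 , 441) ∷ (35 , 1730) ∷ (34 , 200) ∷ [])) ∷ [])) refl tt tt

ps-43×127 : PS (43 * 127)
ps-43×127 = partitionableSet 5461 (orbitPairs 5461 (((1 ∷ []) , ((2667 , 2795) ∷ (5334 , 5203) ∷ (2540 , 4472) ∷ (5207 , 1032) ∷ (2413 , 3483) ∷ (5080 , 3956) ∷ (2286 , 1290) ∷ (4953 , 1333) ∷ (2159 , 602) ∷ (4826 , 2451) ∷ (2032 , 516) ∷ (4699 , 559) ∷ (1905 , 4816) ∷ (4572 , 301) ∷ (1778 , 1204) ∷ (4445 , 129) ∷ (1651 , 2881) ∷ (4318 , 3053) ∷ (1524 , 2236) ∷ (4191 , 1118) ∷ (1397 , 2064) ∷ (1 , 5333) ∷ (5076 , 131) ∷ (1551 , 3529) ∷ (778 , 4175) ∷ (435 , 4391) ∷ (3575 , 1124) ∷ (3576 , 996) ∷ (825 , 3620) ∷ (2761 , 1557) ∷ (1816 , 2375) ∷ (2548 , 1516) ∷ (5258 , 4140) ∷ (1260 , 2550) ∷ (4873 , 4271) ∷ (2982 , 574) ∷ (4574 , 4316) ∷ (4532 , 4231) ∷ (1910 , 1265) ∷ (3760 , 4749) ∷ (5309 , 3073) ∷ (3461 , 4794) ∷ [])) ∷ ((1 ∷ 2409 ∷ 1678 ∷ 3699 ∷ 689 ∷ 1162 ∷ 3957 ∷ 4000 ∷ 3269 ∷ 5118 ∷ 3183 ∷ 3226 ∷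 2022 ∷ 2968 ∷ 3871 ∷ 2796 ∷ 87 ∷ 259 ∷ 4903 ∷ 3785 ∷ 4731 ∷ []) , ((2924 , 1161) ∷ [])) ∷ ((1 ∷ 5333 ∷ 5076 ∷ 131 ∷ 1551 ∷ 3529 ∷ 778 ∷ 4175 ∷ 435 ∷ 4391 ∷ 3575 ∷ 1124 ∷ 3576 ∷ 996 ∷ 825 ∷ 3620 ∷ 2761 ∷ 1557 ∷ 1816 ∷ 2375 ∷ 2548 ∷ 1516 ∷ 5258 ∷ 4140 ∷ 1260 ∷ 2550 ∷ 4873 ∷ 4271 ∷ 2982 ∷ 574 ∷ 4574 ∷ 4316 ∷ 4532 ∷ 4231 ∷ 1910 ∷ 1265 ∷ 3760 ∷ 4749 ∷ 5309 ∷ 3073 ∷ 3461 ∷ 4794 ∷ []) , ((109 , 3403) ∷ (48 , 5045) ∷ (8 , 1442) ∷ (70 , 2670) ∷ (5 , 1637) ∷ (20 , 4771) ∷ (32 , 3707) ∷ (21 , 5291) ∷ (14 , 3520) ∷ (7 , 1661) ∷ (10 , 5175) ∷ (9 , 1038) ∷ (24 , 3953) ∷ (33 , 3581) ∷ (37 , 729) ∷ (28 , 1347) ∷ (6 , 2892) ∷ (2 , 5002) ∷ (16 , 1565) ∷ (56 , 2372) ∷ (40 , 1104) ∷ (31 , 1559) ∷ (73 , 5272) ∷ (74 , 3563) ∷ (22 , 1110) ∷ (49 , 3212) ∷ (17 , 4421) ∷ (3 , 2057) ∷ (132 , 4273) ∷ (12 , 2142) ∷ (4 , 1476) ∷ []))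 ∷ [])) refl tt tt

ps-127×127 : PS (127 * 127)
ps-127×127 = partitionableSet 16129 (orbitPairs 16129 (((1 ∷ 62 ∷ 3844 ∷ 12522 ∷ 2172 ∷ 5632 ∷ 10475 ∷ 4290 ∷ 7916 ∷ 6922 ∷ 9810 ∷ 11447 ∷ 38 ∷ 2356 ∷ 911 ∷ 8095 ∷ 1891 ∷ 4339 ∷ 10954 ∷ 1730 ∷ 10486 ∷ 4972 ∷ 1813 ∷ 15632 ∷ 1444 ∷ 8883 ∷ 2360 ∷ 1159 ∷ 7342 ∷ 3592 ∷ 13027 ∷ 1224 ∷ 11372 ∷ 11517 ∷ 4378 ∷ 13372 ∷ 6485 ∷ 14974 ∷ 9035 ∷ 11784 ∷ 4803 ∷ 7464 ∷ 11156 ∷ 14254 ∷ 12782 ∷ 2163 ∷ 5074 ∷ 8137 ∷ 4495 ∷ 4497 ∷ 4621 ∷ 12309 ∷ 5095 ∷ 9439 ∷ 4574 ∷ 9395 ∷ 1846 ∷ 1549 ∷ 15393 ∷ 2755 ∷ 9520 ∷ 9596 ∷ 14308 ∷ []) , ((16 , 6376) ∷ (77 , 3152) ∷ (3 , 14361) ∷ (1 , 1687) ∷ (22 , 2211) ∷ (6 , 3822) ∷ (7 , 12740) ∷ (50 , 3841) ∷ (20 , 3439) ∷ (60 , 15670) ∷ (11 , 9921) ∷ (13 , 6441) ∷ (37 , 2210) ∷ (142 , 15460) ∷ (112 , 9737) ∷ (36 , 143) ∷ (105 , 9545) ∷ (2 , 188) ∷ (147 , 6492) ∷ (42 , 9081)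 ∷ (30 , 3111) ∷ (34 , 5587) ∷ (239 , 14592) ∷ (4 , 12482) ∷ (92 , 8446) ∷ (47 , 1644) ∷ (12 , 2769) ∷ (19 , 1325) ∷ (101 , 5087) ∷ (48 , 6462) ∷ (175 , 14548) ∷ (73 , 14586) ∷ (49 , 1709) ∷ (35 , 8770) ∷ (127 , 1765) ∷ (149 , 1754) ∷ (148 , 5621) ∷ (55 , 851) ∷ (24 , 13625) ∷ (202 , 3406) ∷ (99 , 1890) ∷ (27 , 14755) ∷ (29 , 13037) ∷ (23 , 15149) ∷ (32 , 11553) ∷ (8 , 14819) ∷ (15 , 7000) ∷ (88 , 14561) ∷ (209 , 340) ∷ (81 , 1694) ∷ (54 , 2201) ∷ (10 , 11402) ∷ (5 , 1127) ∷ (28 , 7498) ∷ (40 , 5188) ∷ (14 , 4309) ∷ (109 , 11378) ∷ (180 , 14325) ∷ (25 , 13472) ∷ (17 , 2265) ∷ (74 , 12769) ∷ (39 , 5401) ∷ (21 , 2190) ∷ (64 , 414) ∷ [])) ∷ [])) refl tt tt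

ps-11×131 : PS (11 * 131)
ps-11×131 = partitionableSet 1441 (orbitPairs 1441 (((1 ∷ []) , ((1310 , 132) ∷ (1179 , 594) ∷ (1048 , 220) ∷ (917 , 1232) ∷ (786 , 451) ∷ (1 , 1178) ∷ (332 , 585) ∷ (1268 , 828) ∷ (708 , 1126) ∷ (1237 , 335) ∷ [])) ∷ ((1 ∷ 463 ∷ 89 ∷ 1101 ∷ 320 ∷ []) , ((396 , 726) ∷ (264 , 1364) ∷ (1331 , 957) ∷ (792 , 1397) ∷ (528 , 638) ∷ (924 , 55) ∷ [])) ∷ ((1 ∷ 1178 ∷ 332 ∷ 585 ∷ 1268 ∷ 828 ∷ 708 ∷ 1126 ∷ 1237 ∷ 335 ∷ []) , ((51 , 1147) ∷ (8 , 672) ∷ (6 , 383) ∷ (5 , 631) ∷ (14 , 841) ∷ (28 , 208) ∷ (70 , 827) ∷ (95 , 632) ∷ (23 , 823) ∷ (18 , 1319) ∷ (17 , 361) ∷ (19 , 186) ∷ (53 , 1182) ∷ (16 , 535) ∷ (2 , 301) ∷ (15 , 901) ∷ (49 , 1022) ∷ (9 , 843) ∷ (3 , 252) ∷ (34 , 878) ∷ (21 , 977) ∷ (4 , 1149) ∷ (20 , 527) ∷ (12 , 432) ∷ (68 , 1090) ∷ (46 , 923) ∷ (60 , 723) ∷ (24 , 1070) ∷ (7 , 387) ∷ (42 , 368) ∷ (30 , 834) ∷ (29 , 498) ∷ [])) ∷ [])) refl tt tt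

ps-131×131 : PS (131 * 131)
ps-131×131 = partitionableSet 17161 (orbitPairs 17161 (((1 ∷ 659 ∷ 5256 ∷ 14343 ∷ 13487 ∷ 15696 ∷ 12742 ∷ 5249 ∷ 9730 ∷ 11017 ∷ 1100 ∷ 4138 ∷ 15504 ∷ 6341 ∷ 8596 ∷ 1634 ∷ 12824 ∷ 7804 ∷ 11697 ∷ 3034 ∷ 8730 ∷ 4135 ∷ 13527 ∷ 7734 ∷ 17050 ∷ 12656 ∷ 58 ∷ 3900 ∷ 13111 ∷ 8166 ∷ 10001 ∷ 835 ∷ 1113 ∷ 12705 ∷ 15188 ∷ 4029 ∷ 12317 ∷ 16911 ∷ 6860 ∷ 7397 ∷ 899 ∷ 8967 ∷ 5869 ∷ 6446 ∷ 9147 ∷ 4362 ∷ 8671 ∷ 16737 ∷ 12321 ∷ 2386 ∷ 10723 ∷ 13286 ∷ 3364 ∷ 3107 ∷ 5354 ∷ 10281 ∷ 13745 ∷ 14108 ∷ 13071 ∷ 16128 ∷ 5693 ∷ 10589 ∷ 10785 ∷ 2661 ∷ 3177 ∷ []) , ((48 , 15297) ∷ (109 , 12639) ∷ (18 , 10794) ∷ (70 , 10232) ∷ (74 , 8355) ∷ (3 , 13659) ∷ (7 , 9694) ∷ (149 , 5189) ∷ (9 , 6726) ∷ (6 , 15994) ∷ (15 , 11217) ∷ (37 , 13898) ∷ (2 , 14743) ∷ (107 , 10994) ∷ (16 , 7711) ∷ (24 , 12148) ∷ (43 , 114) ∷ (68 , 8149) ∷ (14 , 14302) ∷ (77 ,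 7125) ∷ (4 , 10824) ∷ (219 , 14685) ∷ (148 , 5725) ∷ (8 , 11498) ∷ (165 , 15528) ∷ (76 , 2032) ∷ (123 , 7085) ∷ (12 , 8656) ∷ (1 , 14072) ∷ (36 , 15469) ∷ (23 , 13795) ∷ (140 , 13110) ∷ (19 , 2337) ∷ (33 , 7487) ∷ (30 , 2937) ∷ (46 , 2584) ∷ (35 , 12394) ∷ (20 , 12614) ∷ (96 , 9223) ∷ (171 , 10404) ∷ (146 , 7897) ∷ (45 , 4226) ∷ (29 , 14591) ∷ (150 , 14679) ∷ (40 , 10064) ∷ (32 , 2948) ∷ (228 , 2288) ∷ (17 , 4592) ∷ (38 , 10594) ∷ (79 , 191) ∷ (55 , 12352) ∷ (86 , 8892) ∷ (28 , 190) ∷ (113 , 12594) ∷ (128 , 4890) ∷ (241 , 8521) ∷ (26 , 9862) ∷ (50 , 9643) ∷ (25 , 5032) ∷ (106 , 14453) ∷ (11 , 2064) ∷ (56 , 2503) ∷ (53 , 5092) ∷ (41 , 4754) ∷ (61 , 6712) ∷ (73 , 15106) ∷ [])) ∷ [])) refl tt tt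

ps-7×139 : PS (7 * 139)
ps-7×139 = partitionableSet 973 (orbitPairs 973 (((1 ∷ []) , ((834 , 140) ∷ (695 , 791) ∷ (556 , 931) ∷ (1 , 694) ∷ (513 , 877) ∷ (514 , 598) ∷ [])) ∷ ((1 ∷ 652 ∷ 792 ∷ []) , ((840 , 637) ∷ (7 , 343) ∷ (700 , 868) ∷ (560 , 875) ∷ (280 , 21) ∷ (287 , 469) ∷ (161 , 28) ∷ (574 , 896) ∷ (14 , 434) ∷ (567 , 196) ∷ (420 , 441) ∷ [])) ∷ ((1 ∷ 694 ∷ 513 ∷ 877 ∷ 514 ∷ 598 ∷ []) , ((58 , 631) ∷ (37 , 540) ∷ (4 , 113) ∷ (12 , 489) ∷ (23 , 297) ∷ (97 , 247) ∷ (16 , 759) ∷ (46 , 645) ∷ (54 , 767) ∷ (6 , 473) ∷ (8 , 929) ∷ (22 , 901) ∷ (3 , 954) ∷ (10 , 653) ∷ (86 , 291) ∷ (11 , 82) ∷ (24 , 603) ∷ (15 , 878) ∷ (27 , 87) ∷ (31 , 254) ∷ (69 , 79) ∷ (48 , 732) ∷ (20 , 829) ∷ (2 , 204) ∷ (66 , 90) ∷ (30 , 697) ∷ (99 , 326) ∷ (33 , 545) ∷ (5 , 809) ∷ (18 , 880) ∷ (107 , 452) ∷ (9 , 774) ∷ (120 , 758) ∷ (29 , 704) ∷ [])) ∷ [])) refl tt tt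

ps-47×139 : PS (47 * 139)
ps-47×139 = partitionableSet 6533 (orbitPairs 6533 (((1 ∷ []) , ((3197 , 3337) ∷ (6394 , 1363) ∷ (3058 , 2303) ∷ (6255 , 2397) ∷ (2919 , 564) ∷ (6116 , 3149) ∷ (2780 , 1645) ∷ (5977 , 611) ∷ (2641 , 5546) ∷ (5838 , 4371) ∷ (2502 , 893) ∷ (5699 , 6439) ∷ (2363 , 5781) ∷ (5560 , 1316) ∷ (2224 , 5358) ∷ (5421 , 3102) ∷ (2085 , 940) ∷ (5282 , 517) ∷ (1946 , 2867) ∷ (5143 , 6110) ∷ (1807 , 5828) ∷ (5004 , 2021) ∷ (1668 , 3995) ∷ (1 , 6393) ∷ (1224 , 5031) ∷ (5361 , 755) ∷ (2119 , 3858) ∷ (3483 , 2355) ∷ (2732 , 2967) ∷ (4425 , 1135) ∷ (55 , 5366) ∷ (1654 , 3628) ∷ (3676 , 1467) ∷ (3395 , 1609) ∷ (5605 , 5793) ∷ (1611 , 3115) ∷ (343 , 4244) ∷ (1049 , 3399) ∷ (1990 , 2319) ∷ (3025 , 1145) ∷ (5799 , 4765) ∷ (4813 , 5612) ∷ (4720 , 5566) ∷ (1102 , 2512) ∷ (492 , 2983) ∷ (5663 , 4206) ∷ [])) ∷ ((1 ∷ 4560 ∷ 5500 ∷ 5594 ∷ 3761 ∷ 6346 ∷ 4842 ∷ 3808 ∷ 2210 ∷ 1035 ∷ 4090 ∷ 3103 ∷ 2445 ∷ 4513 ∷ 2022 ∷ 6299 ∷ 4137 ∷ 3714 ∷ 6064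 ∷ 2774 ∷ 2492 ∷ 5218 ∷ 659 ∷ []) , ((141 , 4277) ∷ [])) ∷ ((1 ∷ 6393 ∷ 1224 ∷ 5031 ∷ 5361 ∷ 755 ∷ 2119 ∷ 3858 ∷ 3483 ∷ 2355 ∷ 2732 ∷ 2967 ∷ 4425 ∷ 1135 ∷ 55 ∷ 5366 ∷ 1654 ∷ 3628 ∷ 3676 ∷ 1467 ∷ 3395 ∷ 1609 ∷ 5605 ∷ 5793 ∷ 1611 ∷ 3115 ∷ 343 ∷ 4244 ∷ 1049 ∷ 3399 ∷ 1990 ∷ 2319 ∷ 3025 ∷ 1145 ∷ 5799 ∷ 4765 ∷ 4813 ∷ 5612 ∷ 4720 ∷ 5566 ∷ 1102 ∷ 2512 ∷ 492 ∷ 2983 ∷ 5663 ∷ 4206 ∷ []) , ((68 , 1828) ∷ (75 , 1771) ∷ (3 , 2899) ∷ (21 , 6092) ∷ (9 , 576) ∷ (50 , 3324) ∷ (103 , 2469) ∷ (51 , 5632) ∷ (60 , 1948) ∷ (24 , 3376) ∷ (17 , 2516) ∷ (12 , 4831) ∷ (2 , 79) ∷ (14 , 3806) ∷ (36 , 1592) ∷ (131 , 4704) ∷ (25 , 4121) ∷ (11 , 1994) ∷ (4 , 2399) ∷ (33 , 1885) ∷ (23 , 2988) ∷ (67 , 1334) ∷ (41 , 4128) ∷ (43 , 5296) ∷ (201 , 1456) ∷ (59 , 5000) ∷ (63 , 2657) ∷ (20 , 2418) ∷ (8 , 5294) ∷ (5 , 5417) ∷ (42 , 4604) ∷ (30 ,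 1659) ∷ (7 , 5300) ∷ (22 , 3190) ∷ [])) ∷ [])) refl tt tt

ps-139×139 : PS (139 * 139)
ps-139×139 = partitionableSet 19321 (orbitPairs 19321 (((1 ∷ 398 ∷ 3836 ∷ 369 ∷ 11615 ∷ 5051 ∷ 914 ∷ 15994 ∷ 9003 ∷ 8809 ∷ 8881 ∷ 18216 ∷ 4593 ∷ 11840 ∷ 17317 ∷ 13890 ∷ 2414 ∷ 14043 ∷ 5345 ∷ 2000 ∷ 3839 ∷ 1563 ∷ 3802 ∷ 6158 ∷ 16438 ∷ 11826 ∷ 11745 ∷ 18149 ∷ 16569 ∷ 6001 ∷ 11915 ∷ 8525 ∷ 11775 ∷ 10768 ∷ 15723 ∷ 17071 ∷ 12587 ∷ 5487 ∷ 553 ∷ 7563 ∷ 15319 ∷ 10847 ∷ 8523 ∷ 10979 ∷ 3096 ∷ 14985 ∷ 13162 ∷ 2485 ∷ 3659 ∷ 7207 ∷ 8878 ∷ 17022 ∷ 12406 ∷ 10733 ∷ 1793 ∷ 18058 ∷ 18993 ∷ 4703 ∷ 16978 ∷ 14215 ∷ 15838 ∷ 4878 ∷ 9344 ∷ 9280 ∷ 3129 ∷ 8798 ∷ 4503 ∷ 14662 ∷ 534 ∷ []) , ((26 , 17768) ∷ (10 , 16466) ∷ (21 , 4607) ∷ (82 , 1578) ∷ (92 , 15107) ∷ (3 , 125) ∷ (17 , 8369) ∷ (2 , 2629) ∷ (6 , 17400) ∷ (75 , 8411) ∷ (96 , 18669) ∷ (256 , 721) ∷ (85 , 18125) ∷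 (24 , 8548) ∷ (197 , 17392) ∷ (87 , 13739) ∷ (52 , 3583) ∷ (14 , 17802) ∷ (40 , 18606) ∷ (61 , 5770) ∷ (13 , 8064) ∷ (49 , 12985) ∷ (32 , 3067) ∷ (23 , 15522) ∷ (84 , 3473) ∷ (22 , 3972) ∷ (19 , 824) ∷ (4 , 4379) ∷ (98 , 6837) ∷ (25 , 9440) ∷ (31 , 18998) ∷ (28 , 5906) ∷ (137 , 8197) ∷ (129 , 2386) ∷ (58 , 17420) ∷ (48 , 9113) ∷ (71 , 2732) ∷ (100 , 9411) ∷ (5 , 8692) ∷ (149 , 11810) ∷ (76 , 10420) ∷ (29 , 9106) ∷ (30 , 18553) ∷ (43 , 2151) ∷ (215 , 18878) ∷ (166 , 12290) ∷ (69 , 4170) ∷ (163 , 3084) ∷ (167 , 6511) ∷ (53 , 677) ∷ (65 , 16812) ∷ (1 , 16426) ∷ (110 , 4606) ∷ (20 , 11989) ∷ (56 , 3895) ∷ (200 , 17084) ∷ (121 , 5047) ∷ (158 , 4798) ∷ (64 , 14234) ∷ (257 , 8823) ∷ (73 , 10406) ∷ (16 , 6354) ∷ (7 , 13399) ∷ (55 , 7030) ∷ (33 , 3745) ∷ (11 , 6580) ∷ (8 , 18454) ∷ (150 , 15269) ∷ (50 , 6656) ∷ (12 , 13318) ∷ [])) ∷ [])) refl tt tt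

ps-7×151 : PS (7 * 151)
ps-7×151 = partitionableSet 1057 (orbitPairs 1057 (((1 ∷ []) , ((302 , 756) ∷ (604 , 938) ∷ (906 , 637) ∷ (1 , 603) ∷ (485 , 723) ∷ (486 , 269) ∷ [])) ∷ ((1 ∷ 183 ∷ 939 ∷ []) , ((609 , 168) ∷ (917 , 210) ∷ (182 , 497) ∷ (154 , 882) ∷ (308 , 644) ∷ (763 , 777) ∷ (455 , 42) ∷ (322 , 21) ∷ (910 , 245) ∷ (7 , 161) ∷ (630 , 483) ∷ (931 , 98) ∷ [])) ∷ ((1 ∷ 603 ∷ 485 ∷ 723 ∷ 486 ∷ 269 ∷ []) , ((17 , 78) ∷ (15 , 381) ∷ (53 , 650) ∷ (9 , 662) ∷ (34 , 313) ∷ (80 , 926) ∷ (6 , 626) ∷ (25 , 747) ∷ (3 , 160) ∷ (71 , 164) ∷ (4 , 946) ∷ (65 , 865) ∷ (64 , 689) ∷ (62 , 858) ∷ (8 , 824) ∷ (31 , 166) ∷ (26 , 400) ∷ (13 , 856) ∷ (20 , 186) ∷ (2 , 132) ∷ (32 , 176) ∷ (45 , 230) ∷ (41 , 243) ∷ (11 , 923) ∷ (54 , 512) ∷ (69 , 725) ∷ (18 , 582) ∷ (27 , 586) ∷ (36 , 89) ∷ (5 , 43) ∷ (16 , 339) ∷ (29 , 58) ∷ (30 , 479) ∷ (10 , 107) ∷ (52 , 838) ∷ (23 , 206) ∷ (12 , 605) ∷ [])) ∷ [])) refl tt tt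

ps-11×151 : PS (11 * 151)
ps-11×151 = partitionableSet 1661 (orbitPairs 1661 (((1 ∷ []) , ((1057 , 605) ∷ (453 , 132) ∷ (1510 , 517) ∷ (906 , 814) ∷ (302 , 1518) ∷ (1 , 452) ∷ (585 , 321) ∷ (366 , 993) ∷ (59 , 92) ∷ (159 , 445) ∷ [])) ∷ ((1 ∷ 1189 ∷ 1574 ∷ 210 ∷ 914 ∷ []) , ((1210 , 836) ∷ (759 , 803) ∷ (1364 , 1298) ∷ (616 , 1177) ∷ (462 , 1540) ∷ (154 , 242) ∷ (1067 , 649) ∷ [])) ∷ ((1 ∷ 452 ∷ 585 ∷ 321 ∷ 366 ∷ 993 ∷ 59 ∷ 92 ∷ 159 ∷ 445 ∷ []) , ((30 , 48) ∷ (75 , 1382) ∷ (106 , 820) ∷ (25 , 1348) ∷ (13 , 1493) ∷ (9 , 1180) ∷ (69 , 1088) ∷ (3 , 1517) ∷ (19 , 989) ∷ (46 , 1495) ∷ (2 , 65) ∷ (35 , 733) ∷ (49 , 185) ∷ (24 , 82) ∷ (76 , 987) ∷ (43 , 500) ∷ (89 , 718) ∷ (95 , 116) ∷ (10 , 1564) ∷ (58 , 1280) ∷ (16 , 1107) ∷ (29 , 905) ∷ (38 , 320) ∷ (47 , 221) ∷ (27 , 1373) ∷ (8 , 380) ∷ (70 , 1145) ∷ (34 , 625) ∷ (148 , 1031) ∷ (26 , 190) ∷ (12 , 1181) ∷ (6 , 1438) ∷ (4 , 460) ∷ (23 , 105) ∷ (14 , 255) ∷ (7 , 640) ∷ (45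 , 887) ∷ [])) ∷ [])) refl tt tt

ps-31×151 : PS (31 * 151)
ps-31×151 = partitionableSet 4681 (orbitPairs 4681 (((1 ∷ []) , ((3473 , 1209) ∷ (2265 , 2480) ∷ (1057 , 1736) ∷ (4530 , 4247) ∷ (3322 , 2232) ∷ (2114 , 3441) ∷ (906 , 155) ∷ (4379 , 310) ∷ (3171 , 3813) ∷ (1963 , 2418) ∷ (755 , 4402) ∷ (4228 , 217) ∷ (3020 , 4061) ∷ (1812 , 558) ∷ (604 , 3565) ∷ (1 , 2264) ∷ (64 , 4466) ∷ (2793 , 4002) ∷ (4096 , 283) ∷ (873 , 1090) ∷ (874 , 3354) ∷ (1061 , 751) ∷ (8 , 4069) ∷ (2303 , 4039) ∷ (4381 , 4226) ∷ (476 , 1034) ∷ (4445 , 4011) ∷ (2400 , 3640) ∷ (2370 , 1254) ∷ (4169 , 1720) ∷ [])) ∷ ((1 ∷ 1272 ∷ 528 ∷ 3039 ∷ 1024 ∷ 2233 ∷ 3628 ∷ 3783 ∷ 2605 ∷ 1210 ∷ 3194 ∷ 3690 ∷ 2853 ∷ 4031 ∷ 2357 ∷ []) , ((3937 , 713) ∷ (3627 , 2728) ∷ [])) ∷ ((1 ∷ 2264 ∷ 64 ∷ 4466 ∷ 2793 ∷ 4002 ∷ 4096 ∷ 283 ∷ 873 ∷ 1090 ∷ 874 ∷ 3354 ∷ 1061 ∷ 751 ∷ 8 ∷ 4069 ∷ 2303 ∷ 4039 ∷ 4381 ∷ 4226 ∷ 476 ∷ 1034 ∷ 4445 ∷ 4011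 ∷ 2400 ∷ 3640 ∷ 2370 ∷ 1254 ∷ 4169 ∷ 1720 ∷ []) , ((6 , 1590) ∷ (29 , 247) ∷ (44 , 1476) ∷ (23 , 1122) ∷ (26 , 1797) ∷ (21 , 2296) ∷ (83 , 1712) ∷ (10 , 1444) ∷ (22 , 2944) ∷ (11 , 38) ∷ (19 , 1749) ∷ (157 , 4479) ∷ (34 , 1517) ∷ (47 , 928) ∷ (101 , 2031) ∷ (20 , 1063) ∷ (70 , 1629) ∷ (89 , 3898) ∷ (43 , 3431) ∷ (52 , 1182) ∷ (58 , 3044) ∷ (123 , 2738) ∷ (15 , 3405) ∷ (13 , 400) ∷ (3 , 2009) ∷ (85 , 2274) ∷ (5 , 14) ∷ (82 , 1816) ∷ (7 , 4215) ∷ (76 , 2509) ∷ (12 , 3028) ∷ (30 , 1843) ∷ (2 , 3373) ∷ (111 , 1261) ∷ (115 , 2132) ∷ (4 , 4549) ∷ (28 , 1709) ∷ [])) ∷ [])) refl tt tt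

ps-151×151 : PS (151 * 151)
ps-151×151 = partitionableSet 22801 (orbitPairs 22801 (((1 ∷ 206 ∷ 19635 ∷ 9033 ∷ 13917 ∷ 16777 ∷ 13111 ∷ 10348 ∷ 11195 ∷ 3269 ∷ 12185 ∷ 2000 ∷ 1582 ∷ 6678 ∷ 7608 ∷ 16780 ∷ 13729 ∷ 850 ∷ 15493 ∷ 22219 ∷ 16914 ∷ 18532 ∷ 9825 ∷ 17462 ∷ 17415 ∷ 7733 ∷ 19729 ∷ 5596 ∷ 12726 ∷ 22242 ∷ 21652 ∷ 14117 ∷ 12375 ∷ 18339 ∷ 15669 ∷ 12873 ∷ 6922 ∷ 12270 ∷ 19510 ∷ 6084 ∷ 22050 ∷ 4901 ∷ 6362 ∷ 10915 ∷ 13992 ∷ 9426 ∷ 3671 ∷ 3793 ∷ 6124 ∷ 7489 ∷ 15067 ∷ 2866 ∷ 20371 ∷ 1042 ∷ 9443 ∷ 7173 ∷ 18374 ∷ 78 ∷ 16068 ∷ 3863 ∷ 20544 ∷ 13879 ∷ 8949 ∷ 19414 ∷ 9109 ∷ 6772 ∷ 4171 ∷ 15589 ∷ 19194 ∷ 9391 ∷ 19262 ∷ 598 ∷ 9183 ∷ 22016 ∷ 20698 ∷ []) , ((28 , 8069) ∷ (29 , 18421) ∷ (8 , 18597) ∷ (133 , 9425) ∷ (84 , 5014) ∷ (51 , 10926) ∷ (73 , 21034) ∷ (125 , 16388) ∷ (81 , 8341) ∷ (166 , 12166) ∷ (49 , 21122) ∷ (117 , 3436) ∷ (15 , 6143)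 ∷ (257 , 20931) ∷ (39 , 12228) ∷ (7 , 1753) ∷ (21 , 34) ∷ (59 , 9648) ∷ (17 , 14430) ∷ (11 , 18545) ∷ (32 , 16502) ∷ (248 , 905) ∷ (85 , 4705) ∷ (1 , 13931) ∷ (25 , 22079) ∷ (52 , 20666) ∷ (31 , 1467) ∷ (38 , 15066) ∷ (135 , 21119) ∷ (237 , 261) ∷ (24 , 13389) ∷ (148 , 9243) ∷ (12 , 13369) ∷ (14 , 6125) ∷ (136 , 13745) ∷ (35 , 15888) ∷ (16 , 2158) ∷ (162 , 7271) ∷ (60 , 7391) ∷ (105 , 17169) ∷ (2 , 5157) ∷ (20 , 4703) ∷ (361 , 7380) ∷ (87 , 11844) ∷ (45 , 10997) ∷ (104 , 13958) ∷ (33 , 16385) ∷ (128 , 19576) ∷ (13 , 270) ∷ (42 , 20637) ∷ (26 , 17431) ∷ (10 , 6388) ∷ (18 , 11170) ∷ (68 , 3411) ∷ (6 , 8656) ∷ (225 , 5094) ∷ (190 , 5137) ∷ (151 , 2722) ∷ (64 , 18051) ∷ (61 , 1063) ∷ (287 , 14017) ∷ (74 , 21295) ∷ (75 , 5832) ∷ (95 , 13881) ∷ (30 , 18669) ∷ (19 , 19724) ∷ (106 , 11433) ∷ (9 , 21089) ∷ (66 , 13089) ∷ (218 , 12273) ∷ (3 , 7425) ∷ (5 , 15043) ∷ (27 , 1100) ∷ (76 , 17354) ∷ (41 , 18695) ∷ (55 , 15649) ∷ [])) ∷ [])) refl tt tt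

ps-7×163 : PS (7 * 163)
ps-7×163 = partitionableSet 1141 (orbitPairs 1141 (((1 ∷ []) , ((652 , 490) ∷ (163 , 756) ∷ (815 , 105) ∷ (1 , 162) ∷ (919 , 548) ∷ (920 , 710) ∷ [])) ∷ ((1 ∷ 267 ∷ 757 ∷ []) , ((980 , 21) ∷ (7 , 504) ∷ (994 , 546) ∷ (364 , 560) ∷ (658 , 1050) ∷ (1001 , 1015) ∷ (833 , 217) ∷ (497 , 1085) ∷ (168 , 518) ∷ (987 , 259) ∷ (182 , 1029) ∷ (819 , 700) ∷ (329 , 231) ∷ [])) ∷ ((1 ∷ 162 ∷ 919 ∷ 548 ∷ 920 ∷ 710 ∷ []) , ((17 , 275) ∷ (121 , 927) ∷ (5 , 911) ∷ (23 , 1068) ∷ (43 , 362) ∷ (81 , 419) ∷ (80 , 813) ∷ (30 , 71) ∷ (97 , 793) ∷ (94 , 463) ∷ (32 , 341) ∷ (19 , 869) ∷ (22 , 47) ∷ (64 , 677) ∷ (78 , 234) ∷ (39 , 825) ∷ (6 , 761) ∷ (107 , 792) ∷ (83 , 220) ∷ (20 , 782) ∷ (4 , 649) ∷ (38 , 103) ∷ (10 , 68) ∷ (27 , 305) ∷ (101 , 621) ∷ (12 , 566) ∷ (60 , 79) ∷ (26 , 403) ∷ (11 , 44) ∷ (2 , 543) ∷ (8 , 102) ∷ (24 , 713) ∷ (48 , 977) ∷ (9 , 381) ∷ (16 , 18) ∷ (40 , 615) ∷ (29 , 95) ∷ (59 , 76) ∷ (3 , 849) ∷ (34 , 297) ∷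 [])) ∷ [])) refl tt tt

ps-19×163 : PS (19 * 163)
ps-19×163 = partitionableSet 3097 (orbitPairs 3097 (((1 ∷ []) , ((1141 , 1957) ∷ (2282 , 1653) ∷ (326 , 2964) ∷ (1467 , 855) ∷ (2608 , 1520) ∷ (652 , 38) ∷ (1793 , 2223) ∷ (2934 , 1083) ∷ (978 , 2204) ∷ (1 , 2281) ∷ (838 , 629) ∷ (193 , 459) ∷ (2322 , 612) ∷ (1031 , 1088) ∷ (690 , 614) ∷ (919 , 2667) ∷ (920 , 1851) ∷ (85 , 1871) ∷ [])) ∷ ((1 ∷ 2794 ∷ 1008 ∷ 1996 ∷ 2661 ∷ 1179 ∷ 267 ∷ 2224 ∷ 248 ∷ []) , ((2451 , 551) ∷ (2774 , 1729) ∷ (2128 , 2090) ∷ (817 , 1881) ∷ [])) ∷ ((1 ∷ 2281 ∷ 838 ∷ 629 ∷ 193 ∷ 459 ∷ 2322 ∷ 612 ∷ 1031 ∷ 1088 ∷ 690 ∷ 614 ∷ 919 ∷ 2667 ∷ 920 ∷ 1851 ∷ 85 ∷ 1871 ∷ []) , ((49 , 1962) ∷ (51 , 1890) ∷ (42 , 2676) ∷ (7 , 2832) ∷ (29 , 2523) ∷ (30 , 168) ∷ (150 , 747) ∷ (21 , 1946) ∷ (18 , 1745) ∷ (23 , 93) ∷ (178 , 746) ∷ (41 , 2731) ∷ (25 , 39) ∷ (107 , 2673) ∷ (53 , 2463) ∷ (6 , 2000) ∷ (5 , 315) ∷ (98 , 319) ∷ (13 , 848) ∷ (158 , 375) ∷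 (2 , 368) ∷ (3 , 3006) ∷ (55 , 2072) ∷ (103 , 2647) ∷ (9 , 1636) ∷ (58 , 1845) ∷ (26 , 927) ∷ (102 , 833) ∷ (71 , 1783) ∷ (43 , 2229) ∷ (14 , 182) ∷ (45 , 2303) ∷ (31 , 2519) ∷ (33 , 2198) ∷ (90 , 2129) ∷ (17 , 1171) ∷ (35 , 406) ∷ (50 , 2315) ∷ (46 , 2932) ∷ (67 , 613) ∷ [])) ∷ [])) refl tt tt

ps-163×163 : PS (163 * 163)
ps-163×163 = partitionableSet 26569 (orbitPairs 26569 (((1 ∷ 84 ∷ 7056 ∷ 8186 ∷ 23399 ∷ 25979 ∷ 3578 ∷ 8293 ∷ 5818 ∷ 10470 ∷ 2703 ∷ 14500 ∷ 22395 ∷ 21350 ∷ 13277 ∷ 25939 ∷ 218 ∷ 18312 ∷ 23775 ∷ 4425 ∷ 26303 ∷ 4225 ∷ 9503 ∷ 1182 ∷ 19581 ∷ 24095 ∷ 4736 ∷ 25858 ∷ 19983 ∷ 4725 ∷ 24934 ∷ 22074 ∷ 20955 ∷ 6666 ∷ 1995 ∷ 8166 ∷ 21719 ∷ 17704 ∷ 25841 ∷ 18555 ∷ 17618 ∷ 18617 ∷ 22826 ∷ 4416 ∷ 25547 ∷ 20428 ∷ 15536 ∷ 3143 ∷ 24891 ∷ 18462 ∷ 9806 ∷ 65 ∷ 5460 ∷ 6967 ∷ 710 ∷ 6502 ∷ 14788 ∷ 20018 ∷ 7665 ∷ 6204 ∷ 16325 ∷ 16281 ∷ 12585 ∷ 20949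 ∷ 6162 ∷ 12797 ∷ 12188 ∷ 14170 ∷ 21244 ∷ 4373 ∷ 21935 ∷ 9279 ∷ 8935 ∷ 6608 ∷ 23692 ∷ 24022 ∷ 25173 ∷ 15581 ∷ 6923 ∷ 23583 ∷ 14866 ∷ []) , ((39 , 16666) ∷ (72 , 24686) ∷ (229 , 3887) ∷ (11 , 19816) ∷ (82 , 6271) ∷ (17 , 13930) ∷ (153 , 10024) ∷ (35 , 10849) ∷ (13 , 10553) ∷ (9 , 15935) ∷ (68 , 13954) ∷ (136 , 16320) ∷ (54 , 12613) ∷ (55 , 18948) ∷ (51 , 6032) ∷ (53 , 10741) ∷ (181 , 13264) ∷ (34 , 1213) ∷ (33 , 10041) ∷ (27 , 8706) ∷ (61 , 15399) ∷ (41 , 7089) ∷ (264 , 1930) ∷ (1 , 18018) ∷ (29 , 19870) ∷ (97 , 21495) ∷ (115 , 22367) ∷ (99 , 18450) ∷ (188 , 18455) ∷ (151 , 14760) ∷ (129 , 2913) ∷ (28 , 22514) ∷ (81 , 4213) ∷ (108 , 17542) ∷ (46 , 10312) ∷ (21 , 12592) ∷ (12 , 16719) ∷ (23 , 9100) ∷ (10 , 18685) ∷ (145 , 3145) ∷ (96 , 15621) ∷ (20 , 14975) ∷ (121 , 13491) ∷ (111 , 10604) ∷ (119 , 23180) ∷ (59 , 10796) ∷ (85 , 25288) ∷ (254 , 5909) ∷ (36 , 9659) ∷ (80 , 16551) ∷ (64 , 16988) ∷ (4 , 23883) ∷ (25 , 22060) ∷ (70 , 5825) ∷ (125 , 17088)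 ∷ (43 , 18942) ∷ (363 , 6828) ∷ (49 , 8259) ∷ (18 , 16820) ∷ (24 , 19907) ∷ (92 , 16870) ∷ (214 , 22034) ∷ (67 , 9651) ∷ (6 , 1735) ∷ (77 , 17698) ∷ (134 , 3921) ∷ (154 , 14278) ∷ (14 , 8852) ∷ (8 , 13623) ∷ (5 , 16300) ∷ (160 , 3022) ∷ (192 , 232) ∷ (50 , 3799) ∷ (3 , 2922) ∷ (16 , 17226) ∷ (37 , 7664) ∷ (2 , 20512) ∷ (31 , 24039) ∷ (44 , 24935) ∷ (58 , 6310) ∷ (7 , 15055) ∷ (69 , 5882) ∷ [])) ∷ [])) refl tt tt

ps-167×167 : PS (167 * 167)
ps-167×167 = partitionableSet 27889 (orbitPairs 27889 (((1 ∷ 350 ∷ 10944 ∷ 9607 ∷ 15770 ∷ 25367 ∷ 9748 ∷ 9342 ∷ 6687 ∷ 25663 ∷ 1792 ∷ 13642 ∷ 5681 ∷ 8231 ∷ 8283 ∷ 26483 ∷ 9902 ∷ 7464 ∷ 18723 ∷ 27024 ∷ 4029 ∷ 15700 ∷ 867 ∷ 24560 ∷ 6188 ∷ 18347 ∷ 6980 ∷ 16657 ∷ 1149 ∷ 11704 ∷ 24606 ∷ 22288 ∷ 19769 ∷ 2678 ∷ 16963 ∷ 24582 ∷ 13888 ∷ 8114 ∷ 23111 ∷ 1040 ∷ 1443 ∷ 3048 ∷ 7018 ∷ 2068 ∷ 26575 ∷ 14213 ∷ 10308 ∷ 10119 ∷ 27636 ∷ 23006 ∷ 20068 ∷ 23661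 ∷ 26206 ∷ 24508 ∷ 15877 ∷ 7039 ∷ 9418 ∷ 5398 ∷ 20737 ∷ 6810 ∷ 12935 ∷ 9232 ∷ 23965 ∷ 21050 ∷ 4804 ∷ 8060 ∷ 4211 ∷ 23622 ∷ 12556 ∷ 16027 ∷ 3761 ∷ 5567 ∷ 24109 ∷ 15672 ∷ 18956 ∷ 24907 ∷ 16082 ∷ 23011 ∷ 21818 ∷ 22603 ∷ 18463 ∷ 19691 ∷ 3267 ∷ []) , ((570 , 8864) ∷ (85 , 15109) ∷ (51 , 25886) ∷ (95 , 18849) ∷ (28 , 20030) ∷ (46 , 15024) ∷ (52 , 3262) ∷ (30 , 9136) ∷ (20 , 26024) ∷ (59 , 22885) ∷ (47 , 17464) ∷ (56 , 15575) ∷ (236 , 24326) ∷ (48 , 9747) ∷ (38 , 5474) ∷ (18 , 9315) ∷ (4 , 15480) ∷ (105 , 26309) ∷ (133 , 13616) ∷ (41 , 24912) ∷ (29 , 4519) ∷ (15 , 24620) ∷ (190 , 8292) ∷ (197 , 26263) ∷ (9 , 4224) ∷ (50 , 9080) ∷ (37 , 17132) ∷ (201 , 8192) ∷ (11 , 21629) ∷ (335 , 4608) ∷ (181 , 1229) ∷ (5 , 21698) ∷ (82 , 272) ∷ (75 , 16145) ∷ (60 , 19616) ∷ (14 , 19711) ∷ (24 , 2021) ∷ (72 , 9396) ∷ (7 , 12067) ∷ (285 , 10988) ∷ (40 , 13147) ∷ (32 , 16025) ∷ (91 , 1373) ∷ (19 , 12493) ∷ (88 , 18751) ∷ (36 ,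 21931) ∷ (167 , 23099) ∷ (26 , 16914) ∷ (74 , 7447) ∷ (10 , 418) ∷ (49 , 15675) ∷ (144 , 1060) ∷ (34 , 2831) ∷ (23 , 8498) ∷ (123 , 8082) ∷ (100 , 22506) ∷ (2 , 22890) ∷ (67 , 6758) ∷ (27 , 17161) ∷ (3 , 3233) ∷ (25 , 341) ∷ (13 , 13800) ∷ (83 , 25651) ∷ (204 , 15993) ∷ (17 , 15842) ∷ (53 , 16792) ∷ (1 , 4156) ∷ (262 , 720) ∷ (126 , 18484) ∷ (163 , 20060) ∷ (94 , 13094) ∷ (22 , 27165) ∷ (8 , 5711) ∷ (241 , 18838) ∷ (16 , 24295) ∷ (12 , 10692) ∷ (152 , 14347) ∷ (35 , 20134) ∷ (121 , 2846) ∷ (433 , 22482) ∷ (21 , 25758) ∷ (107 , 14637) ∷ (6 , 21197) ∷ (57 , 11327) ∷ [])) ∷ [])) refl tt tt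

ps-179×179 : PS (179 * 179)
ps-179×179 = partitionableSet 32041 (orbitPairs 32041 (((1 ∷ 632 ∷ 14932 ∷ 16970 ∷ 23346 ∷ 15812 ∷ 28433 ∷ 26696 ∷ 18306 ∷ 2591 ∷ 3421 ∷ 15325 ∷ 9018 ∷ 28119 ∷ 20494 ∷ 7644 ∷ 24858 ∷ 10166 ∷ 16712 ∷ 20495 ∷ 8276 ∷ 7749 ∷ 27136 ∷ 8017 ∷ 4266 ∷ 4668 ∷ 2404 ∷ 13401 ∷ 10608 ∷ 7687 ∷ 19993 ∷ 11422 ∷ 9479 ∷ 31102 ∷ 15331 ∷ 12810 ∷ 21588 ∷ 26191 ∷ 19556 ∷ 23607 ∷ 20559 ∷ 16683 ∷ 2167 ∷ 23822 ∷ 28275 ∷ 22963 ∷ 30084 ∷ 12775 ∷ 31509 ∷ 16227 ∷ 2344 ∷ 7522 ∷ 11836 ∷ 14799 ∷ 29037 ∷ 23932 ∷ 1672 ∷ 31392 ∷ 6365 ∷ 17555 ∷ 8574 ∷ 3839 ∷ 23173 ∷ 2599 ∷ 8477 ∷ 6617 ∷ 16614 ∷ 22641 ∷ 18826 ∷ 10821 ∷ 14139 ∷ 28450 ∷ 5399 ∷ 15822 ∷ 2712 ∷ 15811 ∷ 27801 ∷ 11764 ∷ 1336 ∷ 11286 ∷ 19650 ∷ 18933 ∷ 14363 ∷ 9813 ∷ 17903 ∷ 4223 ∷ 9533 ∷ 1148 ∷ 20634 ∷ []) , ((86 , 7201) ∷ (14 , 17758) ∷ (193 , 26854) ∷ (218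 , 6345) ∷ (10 , 4532) ∷ (49 , 23014) ∷ (365 , 2125) ∷ (90 , 26392) ∷ (91 , 13357) ∷ (28 , 26235) ∷ (1 , 21789) ∷ (159 , 20173) ∷ (2 , 4035) ∷ (65 , 9069) ∷ (20 , 30776) ∷ (172 , 28173) ∷ (79 , 24205) ∷ (74 , 12711) ∷ (94 , 9420) ∷ (4 , 20108) ∷ (67 , 25451) ∷ (63 , 16800) ∷ (332 , 3937) ∷ (289 , 30183) ∷ (8 , 2824) ∷ (25 , 22362) ∷ (50 , 27719) ∷ (6 , 5726) ∷ (9 , 28680) ∷ (55 , 3042) ∷ (75 , 545) ∷ (343 , 23637) ∷ (147 , 5681) ∷ (134 , 22479) ∷ (12 , 8312) ∷ (149 , 12408) ∷ (51 , 72) ∷ (118 , 26879) ∷ (124 , 30724) ∷ (244 , 9219) ∷ (35 , 20778) ∷ (16 , 14355) ∷ (15 , 1996) ∷ (59 , 19445) ∷ (43 , 14016) ∷ (34 , 30402) ∷ (3 , 15279) ∷ (101 , 11349) ∷ (202 , 20272) ∷ (126 , 28678) ∷ (78 , 3317) ∷ (117 , 25499) ∷ (21 , 14933) ∷ (183 , 11490) ∷ (83 , 25924) ∷ (122 , 24274) ∷ (76 , 30685) ∷ (30 , 5975) ∷ (18 , 25880) ∷ (133 , 21623) ∷ (26 , 7194) ∷ (73 , 12626) ∷ (265 , 23018) ∷ (61 , 23806) ∷ (185 , 2507) ∷ (19 , 2174) ∷ (150 , 12895) ∷ (106 , 26519) ∷ (179 , 16077) ∷ (57 , 5890) ∷ (11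 , 26827) ∷ (5 , 1816) ∷ (23 , 8893) ∷ (93 , 7692) ∷ (31 , 1189) ∷ (53 , 31249) ∷ (17 , 9618) ∷ (109 , 19254) ∷ (39 , 7033) ∷ (100 , 28318) ∷ (37 , 5232) ∷ (45 , 24745) ∷ (161 , 14898) ∷ (107 , 18349) ∷ (238 , 11645) ∷ (267 , 19236) ∷ (52 , 14452) ∷ (13 , 24723) ∷ (7 , 15968) ∷ (163 , 9680) ∷ [])) ∷ [])) refl tt tt

ps-11×191 : PS (11 * 191)
ps-11×191 = partitionableSet 2101 (orbitPairs 2101 (((1 ∷ []) , ((573 , 1529) ∷ (1146 , 1419) ∷ (1719 , 1386) ∷ (191 , 803) ∷ (764 , 1903) ∷ (1 , 1145) ∷ (464 , 1828) ∷ (1004 , 333) ∷ (994 , 1489) ∷ (566 , 962) ∷ [])) ∷ ((1 ∷ 1992 ∷ 1959 ∷ 1376 ∷ 375 ∷ []) , ((968 , 418) ∷ (770 , 242) ∷ (1540 , 22) ∷ (1914 , 143) ∷ (781 , 1408) ∷ (1155 , 1122) ∷ (385 , 539) ∷ (1727 , 2068) ∷ (957 , 1848) ∷ [])) ∷ ((1 ∷ 1145 ∷ 464 ∷ 1828 ∷ 1004 ∷ 333 ∷ 994 ∷ 1489 ∷ 566 ∷ 962 ∷ []) , ((3 , 351) ∷ (36 , 798) ∷ (42 , 370) ∷ (87 , 1500) ∷ (43 , 1059) ∷ (12 , 918) ∷ (85 , 324) ∷ (17 , 34) ∷ (9 , 1149) ∷ (31 , 168) ∷ (14 , 1256) ∷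 (40 , 1330) ∷ (29 , 723) ∷ (57 , 1763) ∷ (7 , 430) ∷ (19 , 1170) ∷ (35 , 621) ∷ (15 , 1598) ∷ (8 , 1171) ∷ (10 , 1544) ∷ (53 , 144) ∷ (30 , 1164) ∷ (64 , 1867) ∷ (18 , 1783) ∷ (73 , 809) ∷ (2 , 1215) ∷ (27 , 96) ∷ (5 , 1668) ∷ (16 , 1956) ∷ (106 , 665) ∷ (194 , 1297) ∷ (218 , 1620) ∷ (32 , 1476) ∷ (37 , 173) ∷ (248 , 348) ∷ (71 , 493) ∷ (70 , 152) ∷ (102 , 216) ∷ (39 , 441) ∷ (21 , 889) ∷ (6 , 514) ∷ (84 , 786) ∷ (61 , 559) ∷ (13 , 1057) ∷ (60 , 1948) ∷ (119 , 135) ∷ (4 , 545) ∷ [])) ∷ [])) refl tt tt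

ps-191×191 : PS (191 * 191)
ps-191×191 = partitionableSet 36481 (orbitPairs 36481 (((1 ∷ 395 ∷ 10101 ∷ 13466 ∷ 29325 ∷ 18898 ∷ 22586 ∷ 20106 ∷ 25493 ∷ 979 ∷ 21895 ∷ 2528 ∷ 13573 ∷ 35109 ∷ 5275 ∷ 4208 ∷ 20515 ∷ 4643 ∷ 9935 ∷ 20858 ∷ 30685 ∷ 8883 ∷ 6609 ∷ 20404 ∷ 33760 ∷ 19635 ∷ 21853 ∷ 22419 ∷ 27103 ∷ 16752 ∷ 13979 ∷ 13074 ∷ 20409 ∷ 35735 ∷ 33659 ∷ 16221 ∷ 23120 ∷ 12150 ∷ 20239 ∷ 5066 ∷ 31096 ∷ 25304 ∷ 35767 ∷ 9818 ∷ 11124 ∷ 16260 ∷ 2044 ∷ 4798 ∷ 34679 ∷ 17830 ∷ 2017 ∷ 30614 ∷ 17319 ∷ 19058 ∷ 12824 ∷ 31102 ∷ 27674 ∷ 23411 ∷ 17652 ∷ 4669 ∷ 20205 ∷ 28117 ∷ 15991 ∷ 5232 ∷ 23704 ∷ 23944 ∷ 9301 ∷ 25795 ∷ 10826 ∷ 7993 ∷ 19869 ∷ 4840 ∷ 14788 ∷ 4300 ∷ 20374 ∷ 21910 ∷ 8453 ∷ 19164 ∷ 18213 ∷ 7378 ∷ 32311 ∷ 30976 ∷ 14385 ∷ 27520 ∷ 35543 ∷ 30781 ∷ 10322 ∷ 27799 ∷ 36305 ∷ 3442 ∷ 9793 ∷ 1249 ∷ 19102 ∷ 30204 ∷ 1293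 ∷ []) , ((78 , 3083) ∷ (3 , 33781) ∷ (69 , 31439) ∷ (28 , 33396) ∷ (313 , 11247) ∷ (14 , 10062) ∷ (172 , 27490) ∷ (281 , 28719) ∷ (47 , 9925) ∷ (137 , 33611) ∷ (126 , 838) ∷ (43 , 30485) ∷ (63 , 5132) ∷ (38 , 4328) ∷ (147 , 33872) ∷ (154 , 24457) ∷ (66 , 306) ∷ (16 , 35626) ∷ (206 , 17867) ∷ (169 , 25901) ∷ (60 , 13503) ∷ (103 , 13416) ∷ (15 , 31216) ∷ (56 , 35075) ∷ (184 , 28799) ∷ (121 , 6408) ∷ (25 , 294) ∷ (24 , 11982) ∷ (88 , 5179) ∷ (10 , 23924) ∷ (91 , 34094) ∷ (27 , 26781) ∷ (4 , 35060) ∷ (12 , 15331) ∷ (86 , 22727) ∷ (84 , 24136) ∷ (79 , 20803) ∷ (229 , 6979) ∷ (163 , 7794) ∷ (174 , 3065) ∷ (34 , 10258) ∷ (289 , 17997) ∷ (1 , 13465) ∷ (40 , 6107) ∷ (19 , 2671) ∷ (85 , 21109) ∷ (26 , 6890) ∷ (33 , 13229) ∷ (9 , 8076) ∷ (17 , 1931) ∷ (23 , 31256) ∷ (48 , 22346) ∷ (132 , 10475) ∷ (42 , 33082) ∷ (51 , 29678) ∷ (119 , 35804) ∷ (7 , 19638) ∷ (97 , 13092) ∷ (2 , 3631) ∷ (120 , 24958) ∷ (6 , 19489) ∷ (21 , 14390) ∷ (45 , 20662) ∷ (74 , 29115) ∷ (194 , 467) ∷ (170 , 3473) ∷ (94 ,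 8197) ∷ (29 , 35539) ∷ (11 , 29414) ∷ (92 , 3983) ∷ (18 , 23177) ∷ (8 , 19702) ∷ (151 , 33657) ∷ (75 , 23545) ∷ (49 , 30735) ∷ (68 , 33708) ∷ (334 , 34626) ∷ (20 , 11145) ∷ (52 , 24961) ∷ (227 , 26415) ∷ (50 , 13857) ∷ (269 , 24194) ∷ (22 , 34610) ∷ (46 , 20932) ∷ (58 , 6668) ∷ (30 , 31902) ∷ (5 , 30695) ∷ (499 , 25568) ∷ (188 , 16332) ∷ (104 , 11340) ∷ (71 , 14648) ∷ (123 , 30970) ∷ (13 , 20772) ∷ (41 , 17713) ∷ (218 , 6506) ∷ (61 , 26242) ∷ [])) ∷ [])) refl tt tt

ps-7×199 : PS (7 * 199)
ps-7×199 = partitionableSet 1393 (orbitPairs 1393 (((1 ∷ []) , ((995 , 399) ∷ (597 , 504) ∷ (199 , 903) ∷ (1 , 596) ∷ (1101 , 93) ∷ (1102 , 689) ∷ [])) ∷ ((1 ∷ 106 ∷ 505 ∷ []) , ((210 , 882) ∷ (14 , 1281) ∷ (224 , 630) ∷ (203 , 1218) ∷ (602 , 448) ∷ (406 , 924) ∷ (812 , 896) ∷ (637 , 1323) ∷ (1022 , 1113) ∷ (805 , 217) ∷ (1001 , 273) ∷ (1197 , 672) ∷ (798 , 329) ∷ (7 , 1225) ∷ (21 , 910) ∷ (609 , 364) ∷ [])) ∷ ((1 ∷ 596 ∷ 1101 ∷ 93 ∷ 1102 ∷ 689 ∷ []) , ((17 , 61) ∷ (66 , 1111) ∷ (5 ,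 1137) ∷ (78 , 695) ∷ (44 , 412) ∷ (29 , 522) ∷ (102 , 1044) ∷ (53 , 307) ∷ (37 , 941) ∷ (71 , 551) ∷ (19 , 563) ∷ (4 , 1178) ∷ (106 , 1066) ∷ (20 , 283) ∷ (11 , 474) ∷ (25 , 845) ∷ (6 , 12) ∷ (169 , 227) ∷ (88 , 681) ∷ (80 , 485) ∷ (54 , 160) ∷ (23 , 711) ∷ (74 , 117) ∷ (92 , 669) ∷ (141 , 788) ∷ (52 , 814) ∷ (31 , 1122) ∷ (59 , 323) ∷ (50 , 431) ∷ (13 , 79) ∷ (39 , 953) ∷ (32 , 303) ∷ (18 , 1146) ∷ (40 , 612) ∷ (3 , 755) ∷ (36 , 774) ∷ (73 , 386) ∷ (26 , 578) ∷ (9 , 508) ∷ (76 , 1020) ∷ (68 , 594) ∷ (8 , 583) ∷ (10 , 1231) ∷ (114 , 592) ∷ (46 , 758) ∷ (2 , 206) ∷ (137 , 379) ∷ (34 , 872) ∷ (38 , 288) ∷ [])) ∷ [])) refl tt tt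

ps-19×199 : PS (19 * 199)
ps-19×199 = partitionableSet 3781 (orbitPairs 3781 (((1 ∷ []) , ((3383 , 399) ∷ (2985 , 3420) ∷ (2587 , 817) ∷ (2189 , 1767) ∷ (1791 , 456) ∷ (1393 , 3762) ∷ (995 , 703) ∷ (597 , 1102) ∷ (199 , 2033) ∷ (1 , 2984) ∷ (2624 , 3346) ∷ (3404 , 1770) ∷ (175 , 422) ∷ (2247 , 1335) ∷ (1374 , 1412) ∷ (1698 , 292) ∷ (1699 , 3276) ∷ (2232 , 1947) ∷ [])) ∷ ((1 ∷ 3022 ∷ 419 ∷ 1369 ∷ 58 ∷ 3364 ∷ 305 ∷ 704 ∷ 1635 ∷ []) , ((1596 , 2565) ∷ (1197 , 2280) ∷ (3591 , 2489) ∷ (798 , 1938) ∷ (2394 , 1710) ∷ [])) ∷ ((1 ∷ 2984 ∷ 2624 ∷ 3346 ∷ 3404 ∷ 1770 ∷ 175 ∷ 422 ∷ 2247 ∷ 1335 ∷ 1374 ∷ 1412 ∷ 1698 ∷ 292 ∷ 1699 ∷ 3276 ∷ 2232 ∷ 1947 ∷ []) , ((59 , 2578) ∷ (39 , 2103) ∷ (92 , 3221) ∷ (16 , 660) ∷ (27 , 109) ∷ (14 , 28) ∷ (56 , 3352) ∷ (9 , 3358) ∷ (20 , 1839) ∷ (54 , 386) ∷ (96 , 2226) ∷ (25 , 3706) ∷ (40 , 1070) ∷ (13 , 3076) ∷ (10 , 316) ∷ (46 , 567) ∷ (2 , 3405) ∷ (6 , 2123) ∷ (31 , 1535) ∷ (58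 , 416) ∷ (4 , 1895) ∷ (124 , 529) ∷ (50 , 1276) ∷ (12 , 2084) ∷ (26 , 1327) ∷ (53 , 3597) ∷ (93 , 582) ∷ (112 , 959) ∷ (3 , 1180) ∷ (193 , 2899) ∷ (73 , 2075) ∷ (177 , 3023) ∷ (84 , 1551) ∷ (21 , 1792) ∷ (71 , 1068) ∷ (82 , 1646) ∷ (42 , 2439) ∷ (279 , 1949) ∷ (37 , 1106) ∷ (36 , 1191) ∷ (52 , 1869) ∷ (7 , 2969) ∷ (8 , 3093) ∷ (29 , 2718) ∷ (81 , 1890) ∷ (229 , 2569) ∷ (123 , 163) ∷ (5 , 2900) ∷ (164 , 1766) ∷ [])) ∷ [])) refl tt tt

ps-23×199 : PS (23 * 199)
ps-23×199 = partitionableSet 4577 (orbitPairs 4577 (((1 ∷ []) , ((3980 , 598) ∷ (3383 , 1518) ∷ (2786 , 1058) ∷ (2189 , 2093) ∷ (1592 , 2967) ∷ (995 , 4094) ∷ (398 , 4117) ∷ (4378 , 736) ∷ (3781 , 2576) ∷ (3184 , 138) ∷ (2587 , 874) ∷ (1 , 3382) ∷ (324 , 1865) ∷ (3844 , 1728) ∷ (4282 , 96) ∷ (4559 , 3202) ∷ (512 , 1478) ∷ (4515 , 858) ∷ (537 , 3642) ∷ (1780 , 1205) ∷ (3322 , 3046) ∷ (3461 , 1713) ∷ [])) ∷ ((1 ∷ 921 ∷ 461 ∷ 1496 ∷ 2370 ∷ 3497 ∷ 3520 ∷ 139 ∷ 1979 ∷ 4118 ∷ 277 ∷ []) , ((1794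 , 2944) ∷ (3588 , 3956) ∷ (1196 , 1104) ∷ (805 , 3358) ∷ [])) ∷ ((1 ∷ 3382 ∷ 324 ∷ 1865 ∷ 3844 ∷ 1728 ∷ 4282 ∷ 96 ∷ 4559 ∷ 3202 ∷ 512 ∷ 1478 ∷ 4515 ∷ 858 ∷ 537 ∷ 3642 ∷ 1780 ∷ 1205 ∷ 3322 ∷ 3046 ∷ 3461 ∷ 1713 ∷ []) , ((39 , 2857) ∷ (26 , 649) ∷ (5 , 614) ∷ (61 , 159) ∷ (13 , 1193) ∷ (2 , 694) ∷ (63 , 1935) ∷ (7 , 3260) ∷ (45 , 971) ∷ (40 , 2692) ∷ (83 , 3846) ∷ (22 , 1481) ∷ (60 , 361) ∷ (52 , 2992) ∷ (10 , 2271) ∷ (51 , 1969) ∷ (33 , 546) ∷ (21 , 2174) ∷ (17 , 521) ∷ (56 , 101) ∷ (88 , 3229) ∷ (15 , 783) ∷ (14 , 979) ∷ (55 , 4166) ∷ (30 , 3517) ∷ (8 , 2270) ∷ (47 , 1306) ∷ (117 , 408) ∷ (78 , 3630) ∷ (29 , 2974) ∷ (34 , 822) ∷ (43 , 3935) ∷ (4 , 2456) ∷ (20 , 1213) ∷ (44 , 70) ∷ (86 , 1384) ∷ (210 , 1029) ∷ (129 , 1795) ∷ (28 , 312) ∷ (136 , 965) ∷ (11 , 1594) ∷ (3 , 2653) ∷ (77 , 2276) ∷ (12 , 2929) ∷ (24 , 3508) ∷ (37 , 3120) ∷ (9 , 2264) ∷ (59 , 2409) ∷ (102 , 2519) ∷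 [])) ∷ [])) refl tt tt

ps-67×199 : PS (67 * 199)
ps-67×199 = partitionableSet 13333 (orbitPairs 13333 (((1 ∷ []) , ((6567 , 6767) ∷ (13134 , 9380) ∷ (6368 , 7437) ∷ (12935 , 13266) ∷ (6169 , 335) ∷ (12736 , 804) ∷ (5970 , 7638) ∷ (12537 , 11524) ∷ (5771 , 3685) ∷ (12338 , 9045) ∷ (5572 , 4154) ∷ (12139 , 8375) ∷ (5373 , 10519) ∷ (11940 , 6231) ∷ (5174 , 11457) ∷ (11741 , 4489) ∷ (4975 , 9849) ∷ (11542 , 6164) ∷ (4776 , 1139) ∷ (11343 , 4221) ∷ (4577 , 5226) ∷ (11144 , 5494) ∷ (4378 , 11658) ∷ (10945 , 12797) ∷ (4179 , 5561) ∷ (10746 , 4020) ∷ (3980 , 6030) ∷ (10547 , 8241) ∷ (3781 , 9246) ∷ (10348 , 2680) ∷ (3582 , 6901) ∷ (10149 , 1206) ∷ (3383 , 737) ∷ (1 , 13133) ∷ (9181 , 3754) ∷ (472 , 12264) ∷ (12868 , 13002) ∷ (6504 , 5834) ∷ (207 , 11932) ∷ (275 , 11665) ∷ (10728 , 1013) ∷ (9456 , 2086) ∷ (8050 , 3293) ∷ (9726 , 1418) ∷ (7181 , 3764) ∷ (2559 , 8187) ∷ (4838 , 5709) ∷ (3298 , 7050) ∷ (2897 , 7252) ∷ (1491 , 8459) ∷ (4373 , 5378) ∷ (5915 , 3637) ∷ (2231 , 7122) ∷ (9803 , 12684) ∷ (3305 , 5650) ∷ (2703 , 6053) ∷ (10409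 , 11481) ∷ (9740 , 11951) ∷ (1433 , 6726) ∷ (10010 , 11283) ∷ (5455 , 2306) ∷ (13027 , 7868) ∷ (13028 , 7668) ∷ (10483 , 10014) ∷ (11355 , 8943) ∷ (4120 , 2646) ∷ [])) ∷ ((1 ∷ 2614 ∷ 671 ∷ 6500 ∷ 6902 ∷ 7371 ∷ 872 ∷ 4758 ∷ 10252 ∷ 2279 ∷ 10721 ∷ 1609 ∷ 3753 ∷ 12798 ∷ 4691 ∷ 11056 ∷ 3083 ∷ 12731 ∷ 7706 ∷ 10788 ∷ 11793 ∷ 12061 ∷ 4892 ∷ 6031 ∷ 12128 ∷ 10587 ∷ 12597 ∷ 1475 ∷ 2480 ∷ 9247 ∷ 135 ∷ 7773 ∷ 7304 ∷ []) , ((201 , 10318) ∷ [])) ∷ ((1 ∷ 13133 ∷ 9181 ∷ 3754 ∷ 472 ∷ 12264 ∷ 12868 ∷ 13002 ∷ 6504 ∷ 5834 ∷ 207 ∷ 11932 ∷ 275 ∷ 11665 ∷ 10728 ∷ 1013 ∷ 9456 ∷ 2086 ∷ 8050 ∷ 3293 ∷ 9726 ∷ 1418 ∷ 7181 ∷ 3764 ∷ 2559 ∷ 8187 ∷ 4838 ∷ 5709 ∷ 3298 ∷ 7050 ∷ 2897 ∷ 7252 ∷ 1491 ∷ 8459 ∷ 4373 ∷ 5378 ∷ 5915 ∷ 3637 ∷ 2231 ∷ 7122 ∷ 9803 ∷ 12684 ∷ 3305 ∷ 5650 ∷ 2703 ∷ 6053 ∷ 10409 ∷ 11481 ∷ 9740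 ∷ 11951 ∷ 1433 ∷ 6726 ∷ 10010 ∷ 11283 ∷ 5455 ∷ 2306 ∷ 13027 ∷ 7868 ∷ 13028 ∷ 7668 ∷ 10483 ∷ 10014 ∷ 11355 ∷ 8943 ∷ 4120 ∷ 2646 ∷ []) , ((29 , 8661) ∷ (46 , 12955) ∷ (19 , 12047) ∷ (45 , 3960) ∷ (27 , 1198) ∷ (4 , 1485) ∷ (9 , 28) ∷ (8 , 6024) ∷ (21 , 5329) ∷ (5 , 4099) ∷ (35 , 10137) ∷ (54 , 733) ∷ (3 , 4547) ∷ (39 , 960) ∷ (26 , 58) ∷ (17 , 1616) ∷ (60 , 6001) ∷ (232 , 11648) ∷ (14 , 5733) ∷ (65 , 154) ∷ (116 , 842) ∷ (100 , 11609) ∷ (83 , 2429) ∷ (18 , 1219) ∷ (146 , 9690) ∷ (15 , 6651) ∷ (101 , 10214) ∷ (50 , 2244) ∷ (56 , 12349) ∷ (31 , 12195) ∷ (42 , 8722) ∷ (52 , 5168) ∷ (69 , 9210) ∷ (30 , 8855) ∷ (98 , 8386) ∷ (7 , 5363) ∷ (37 , 9635) ∷ (12 , 9657) ∷ (10 , 6571) ∷ (24 , 769) ∷ (75 , 8266) ∷ (2 , 9230) ∷ (43 , 8259) ∷ (139 , 2063) ∷ (13 , 1190) ∷ (23 , 878) ∷ (73 , 2775) ∷ (6 , 4681) ∷ (105 , 3903) ∷ [])) ∷ [])) refl tt tt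

ps-199×199 : PS (199 * 199)
ps-199×199 = partitionableSet 39601 (orbitPairs 39601 (((1 ∷ 667 ∷ 9278 ∷ 10670 ∷ 28311 ∷ 33361 ∷ 35626 ∷ 1942 ∷ 28082 ∷ 39022 ∷ 9817 ∷ 13774 ∷ 39427 ∷ 2745 ∷ 9269 ∷ 4667 ∷ 24011 ∷ 16533 ∷ 18433 ∷ 18501 ∷ 24256 ∷ 21544 ∷ 34286 ∷ 18985 ∷ 30276 ∷ 37183 ∷ 10835 ∷ 19563 ∷ 19792 ∷ 14131 ∷ 339 ∷ 28108 ∷ 16763 ∷ 13439 ∷ 13987 ∷ 23094 ∷ 38510 ∷ 24722 ∷ 15558 ∷ 1724 ∷ 1479 ∷ 36069 ∷ 20216 ∷ 19732 ∷ 13712 ∷ 37674 ∷ 21524 ∷ 20946 ∷ 31430 ∷ 14881 ∷ 25377 ∷ 16832 ∷ 19861 ∷ 20553 ∷ 6905 ∷ 11919 ∷ 29773 ∷ 18490 ∷ 16919 ∷ 38289 ∷ 35719 ∷ 24372 ∷ 19714 ∷ 1706 ∷ 29074 ∷ 27469 ∷ 26161 ∷ 24947 ∷ 7229 ∷ 30022 ∷ 26169 ∷ 30283 ∷ 2251 ∷ 36180 ∷ 15051 ∷ 19964 ∷ 10052 ∷ 12115 ∷ 2101 ∷ 15332 ∷ 9386 ∷ 3504 ∷ 709 ∷ 37292 ∷ 4336 ∷ 1239 ∷ 34393 ∷ 11152 ∷ 32997 ∷ 30444 ∷ 30436 ∷ 25100 ∷ 30078 ∷ 23920 ∷ 35038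 ∷ 5756 ∷ 37556 ∷ 22020 ∷ 34970 ∷ []) , ((27 , 25630) ∷ (108 , 3744) ∷ (324 , 14463) ∷ (183 , 32040) ∷ (32 , 4368) ∷ (211 , 6769) ∷ (64 , 198) ∷ (90 , 31879) ∷ (180 , 20170) ∷ (128 , 31177) ∷ (9 , 29427) ∷ (98 , 38528) ∷ (70 , 9155) ∷ (2 , 22546) ∷ (20 , 2651) ∷ (5 , 12111) ∷ (182 , 14242) ∷ (104 , 8992) ∷ (15 , 10057) ∷ (26 , 4294) ∷ (82 , 28247) ∷ (124 , 9649) ∷ (22 , 31637) ∷ (65 , 38730) ∷ (58 , 38665) ∷ (12 , 39041) ∷ (422 , 10901) ∷ (155 , 5738) ∷ (268 , 9978) ∷ (91 , 11300) ∷ (40 , 15759) ∷ (123 , 38574) ∷ (283 , 3709) ∷ (96 , 18206) ∷ (1 , 37488) ∷ (19 , 18296) ∷ (192 , 21028) ∷ (53 , 38830) ∷ (72 , 26704) ∷ (30 , 36250) ∷ (21 , 20106) ∷ (203 , 35413) ∷ (45 , 34728) ∷ (86 , 7332) ∷ (129 , 17251) ∷ (31 , 285) ∷ (77 , 18292) ∷ (89 , 19247) ∷ (107 , 19798) ∷ (42 , 14558) ∷ (152 , 6625) ∷ (43 , 25613) ∷ (109 , 2579) ∷ (179 , 25103) ∷ (87 , 8072) ∷ (296 , 15179) ∷ (75 , 33161) ∷ (4 , 3589) ∷ (3 , 27034) ∷ (18 , 34046) ∷ (24 , 32335) ∷ (154 , 36010) ∷ (67 , 8873) ∷ (249 ,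 9275) ∷ (11 , 34925) ∷ (61 , 7068) ∷ (16 , 33079) ∷ (50 , 9708) ∷ (29 , 26626) ∷ (166 , 13226) ∷ (83 , 34973) ∷ (14 , 27396) ∷ (114 , 4590) ∷ (6 , 32074) ∷ (111 , 2729) ∷ (247 , 10268) ∷ (73 , 37893) ∷ (8 , 15318) ∷ (57 , 16975) ∷ (33 , 29158) ∷ (10 , 23698) ∷ (122 , 37512) ∷ (388 , 26967) ∷ (44 , 25271) ∷ (41 , 14823) ∷ (49 , 7142) ∷ (25 , 32238) ∷ (148 , 18430) ∷ (546 , 19960) ∷ (35 , 11756) ∷ (292 , 36953) ∷ (74 , 18176) ∷ (66 , 33438) ∷ (55 , 14716) ∷ (36 , 39206) ∷ (216 , 7050) ∷ (7 , 5768) ∷ (81 , 134) ∷ (120 , 15761) ∷ (76 , 21336) ∷ [])) ∷ [])) refl tt tt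

knownPSs : List KnownPS
knownPSs =
  knownPS 7 7 ps-7×7 ∷
  knownPS 11 11 ps-11×11 ∷
  knownPS 7 19 ps-7×19 ∷
  knownPS 19 19 ps-19×19 ∷
  knownPS 23 23 ps-23×23 ∷
  knownPS 7 31 ps-7×31 ∷
  knownPS 11 31 ps-11×31 ∷
  knownPS 31 31 ps-31×31 ∷
  knownPS 7 43 ps-7×43 ∷
  knownPS 43 43 ps-43×43 ∷
  knownPS 47 47 ps-47×47 ∷
  knownPS 59 59 ps-59×59 ∷
  knownPS 7 67 ps-7×67 ∷
  knownPS 23 67 ps-23×67 ∷
  knownPS 67 67 ps-67×67 ∷
  knownPS 11 71 ps-11×71 ∷
  knownPS 71 71 ps-71×71 ∷
  knownPS 7 79 ps-7×79 ∷
  knownPS 79 79 ps-79×79 ∷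
  knownPS 83 83 ps-83×83 ∷
  knownPS 7 103 ps-7×103 ∷
  knownPS 103 103 ps-103×103 ∷
  knownPS 107 107 ps-107×107 ∷
  knownPS 7 127 ps-7×127 ∷
  knownPS 19 127 ps-19×127 ∷
  knownPS 43 127 ps-43×127 ∷
  knownPS 127 127 ps-127×127 ∷
  knownPS 11 131 ps-11×131 ∷
  knownPS 131 131 ps-131×131 ∷
  knownPS 7 139 ps-7×139 ∷
  knownPS 47 139 ps-47×139 ∷
  knownPS 139 139 ps-139×139 ∷
  knownPS 7 151 ps-7×151 ∷
  knownPS 11 151 ps-11×151 ∷
  knownPS 31 151 ps-31×151 ∷
  knownPS 151 151 ps-151×151 ∷
  knownPS 7 163 ps-7×163 ∷
  knownPS 19 163 ps-19×163 ∷
  knownPS 163 163 ps-163×163 ∷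
  knownPS 167 167 ps-167×167 ∷
  knownPS 179 179 ps-179×179 ∷
  knownPS 11 191 ps-11×191 ∷
  knownPS 191 191 ps-191×191 ∷
  knownPS 7 199 ps-7×199 ∷
  knownPS 19 199 ps-19×199 ∷
  knownPS 23 199 ps-23×199 ∷
  knownPS 67 199 ps-67×199 ∷
  knownPS 199 199 ps-199×199 ∷
  []

knownPSs-complete : CompleteBelow 200 knownPSs
knownPSs-complete = toWitness {a? = completeBelow? 200 knownPSs} tt

theorem5p4 : (p q : ℕ) → Prime q → q % 4 ≡ 3 → 3 < q → q < 200 →
             Prime p → p % 4 ≡ 3 → 3 < p → (p ∸ 1) ∣ (q ∸ 1) →
             PS (p * q)
theorem5p4 p q q-prime q%4≡3 3<q q<200 p-prime p%4≡3 3<p p-1∣q-1 =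
  lookupPS knownPSs (knownPSs-complete q<200 p<200 (q%4≡3 , p%4≡3 , 3<q , 3<p , p-1∣q-1 , q-prime , p-prime))
  where
  p<200 : p < 200
  p<200 = ℕ.≤-<-trans (∣-pred⇒≤ (ℕ.≤-<-trans (s≤s z≤n) 3<q) p-1∣q-1) q<200
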